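{- Let $y^1,y^2$ be a pair of vertices of the bounded-size partition polytope $PP(\kappa^\pm)$. Then $y^1$ and $y^2$ share an edge of $PP(\kappa^\pm)$ if and only if $CDG(y^1,y^2)$ cannot be non-trivially decomposed into valid $CDG$s at $y^1$. Equivalently, $y^1$ and $y^2$ share an edge if and only if $CDG(y^1,y^2)$ is a single edge, a single directed path in which no interior node is free, or a single directed cycle in which at most one node is free.
   Context: Let $X=\{x_1,\dots,x_n\}$ be items, $k$ clusters, and $\kappa_i^-,\kappa_i^+\in\mathbb Z_+$. $PP(\kappa^\pm)$ is the set of $y\in\mathbb R^{kn}$ with $\sum_{i=1}^k y_{ij}=1$ ($j=1,\dots,n$), $\kappa_i^-\le\sum_{j=1}^n y_{ij}\le\kappa_i^+$ ($i=1,\dots,k$), $y_{ij}\ge 0$. Its vertices are the $y\in\{0,1\}^{kn}$ satisfying these constraints; such $y$ corresponds to the clustering $C=(C_1,\dots,C_k)$ with $C_i=\{x_j: y_{ij}=1\}$. For vertices $y^1,y^2$ with clusterings $C^1,C^2$, the clustering difference graph $CDG(y^1,y^2)$ is the directed multigraph on nodes $c_1,\dots,c_k$ having an edge $(c_i,c_\ell)$ with label $x_j$ exactly when $y^1_{ij}=y^2_{\ell j}=1$ and $i\ne\ell$ (its structure refers to the subgraph formed by its edges). Node $c_i$ is free if $\kappa_i^-<|C^1_i|<\kappa_i^+$. A labeled directed graph $D$ on $c_1,\dots,c_k$ is a valid $CDG$ at $y^1$ if $D=CDG(y^1,y')$ for some vertex $y'$ of $PP(\kappa^\pm)$. A non-trivial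 decomposition of $CDG(y^1,y^2)$ into valid $CDG$s at $y^1$ is a partition of its edge set into at least two nonempty parts each of which is a valid $CDG$ at $y^1$. -}

module Defs where

open import Data.Nat using (ℕ; zero; suc; _≤_; _<_)
open import Data.Integer as ℤ using (ℤ; +_)
open import Data.Fin using (Fin; zero; suc; toℕ; inject₁; fromℕ)
open import Data.Product using (Σ; ∃; ∃-syntax; _×_; _,_)
open import Data.Sum using (_⊎_)
open import Relation.Binary.PropositionalEquality using (_≡_; _≢_)
open import Relation.Nullary using (¬_)
open import Function.Bundles using (_⇔_)

Σℕ : ∀ {n} → (Fin n → ℕ) → ℕ
Σℕ {zero}  f = 0
Σℕ {suc n} f = f zero Data.Nat.+ Σℕ (λ j → f (suc j))

Σℤ : ∀ {n} → (Fin n → ℤ) → ℤ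
Σℤ {zero}  f = + 0
Σℤ {suc n} f = f zero ℤ.+ Σℤ (λ j → f (suc j))

-- Points of ℝ^{kn} with 0/1 (natural-number) coordinates: y i j = y_{ij},
-- i : cluster index (Fin k), j : item index (Fin n).

Pt : ℕ → ℕ → Set
Pt k n = Fin k → Fin n → ℕ

_≐_ : ∀ {k n} → Pt k n → Pt k n → Set
y ≐ z = ∀ i j → y i j ≡ z i j

size : ∀ {k n} → Pt k n → Fin k → ℕ
size y i = Σℕ (λ j → y i j)

IsVertex : ∀ {k n} (κ⁻ κ⁺ : Fin k → ℕ) → Pt k n → Set
IsVertex {k} {n} κ⁻ κ⁺ y =
  (∀ i j → y i j ≤ 1) ×
  (∀ j → Σℕ (λ i → y i j) ≡ 1) ×
  (∀ i → κ⁻ i ≤ size y i × size y i ≤ κ⁺ i)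

dot : ∀ {k n} → (Fin k → Fin n → ℤ) → Pt k n → ℤ
dot c y = Σℤ (λ i → Σℤ (λ j → c i j ℤ.* + y i j))

-- y¹ and y² (distinct vertices) share an edge of PP(κ±): the segment
-- conv{y¹,y²} is a face, i.e. it is the set of maximisers over the polytope
-- (= conv of its vertices) of some linear functional c.
ShareEdge : ∀ {k n} (κ⁻ κ⁺ : Fin k → ℕ) → Pt k n → Pt k n → Set
ShareEdge {k} {n} κ⁻ κ⁺ y¹ y² =
  ∃[ c ] (dot c y¹ ≡ dot c y² ×
          (∀ z → IsVertex κ⁻ κ⁺ z → ¬ (z ≐ y¹) → ¬ (z ≐ y²) →
             dot c z ℤ.< dot c y¹))

-- Labeled directed (multi)graphs on nodes c_1..c_k with labels x_1..x_n:
-- D i ℓ j  means "there is an edge (c_i , c_ℓ) with label x_j".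

LGraph : ℕ → ℕ → Set₁
LGraph k n = Fin k → Fin k → Fin n → Set

CDG : ∀ {k n} → Pt k n → Pt k n → LGraph k n
CDG y¹ y² i ℓ j = (y¹ i j ≡ 1) × (y² ℓ j ≡ 1) × (i ≢ ℓ)

_≅_ : ∀ {k n} → LGraph k n → LGraph k n → Set
D ≅ E = ∀ i ℓ j → D i ℓ j ⇔ E i ℓ j

ValidCDG : ∀ {k n} (κ⁻ κ⁺ : Fin k → ℕ) → Pt k n → LGraph k n → Set
ValidCDG κ⁻ κ⁺ y¹ D = ∃[ y' ] (IsVertex κ⁻ κ⁺ y' × D ≅ CDG y¹ y')

NonEmpty : ∀ {k n} → LGraph k n → Set
NonEmpty D = ∃[ i ] ∃[ ℓ ] ∃[ j ] D i ℓ j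

NontrivialDecomposition : ∀ {k n} (κ⁻ κ⁺ : Fin k → ℕ) → Pt k n → LGraph k n → Set₁
NontrivialDecomposition {k} {n} κ⁻ κ⁺ y¹ D =
  ∃[ m ] Σ (Fin m → LGraph k n) λ P →
    (2 ≤ m) ×
    (∀ p i ℓ j → P p i ℓ j → D i ℓ j) ×
    (∀ i ℓ j → D i ℓ j → ∃[ p ] P p i ℓ j) ×
    (∀ p q i ℓ j → P p i ℓ j → P q i ℓ j → p ≡ q) ×
    (∀ p → NonEmpty (P p)) ×
    (∀ p → ValidCDG κ⁻ κ⁺ y¹ (P p))

Free : ∀ {k n} (κ⁻ κ⁺ : Fin k → ℕ) → Pt k n → Fin k → Set
Free κ⁻ κ⁺ y¹ i = κ⁻ i < size y¹ i × size y¹ i < κ⁺ i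

SingleEdge : ∀ {k n} → LGraph k n → Set
SingleEdge D = ∃[ i ] ∃[ ℓ ] ∃[ j ]
  (D i ℓ j × (∀ i' ℓ' j' → D i' ℓ' j' → i' ≡ i × ℓ' ≡ ℓ × j' ≡ j))

WalkEdges : ∀ {k n r} → LGraph k n → (Fin (suc r) → Fin k) → (Fin r → Fin n) → Set
WalkEdges {r = r} D v lab =
  ∀ i ℓ j → D i ℓ j ⇔ (∃[ t ] (i ≡ v (inject₁ t) × ℓ ≡ v (suc t) × j ≡ lab t))

PathNoFreeInterior : ∀ {k n} (κ⁻ κ⁺ : Fin k → ℕ) → Pt k n → LGraph k n → Set
PathNoFreeInterior {k} {n} κ⁻ κ⁺ y¹ D =
  ∃[ r ] Σ (Fin (suc r) → Fin k) λ v → Σ (Fin r → Fin n) λ lab →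
    (1 ≤ r) ×
    (∀ s s' → v s ≡ v s' → s ≡ s') ×
    WalkEdges D v lab ×
    (∀ s → 0 < toℕ s → toℕ s < r → ¬ Free κ⁻ κ⁺ y¹ (v s))

CycleAtMostOneFree : ∀ {k n} (κ⁻ κ⁺ : Fin k → ℕ) → Pt k n → LGraph k n → Set
CycleAtMostOneFree {k} {n} κ⁻ κ⁺ y¹ D =
  ∃[ r ] Σ (Fin (suc r) → Fin k) λ v → Σ (Fin r → Fin n) λ lab →
    (2 ≤ r) ×
    (v (fromℕ r) ≡ v zero) ×
    (∀ s s' → v (inject₁ s) ≡ v (inject₁ s') → s ≡ s') ×
    WalkEdges D v lab ×
    (∀ s s' → Free κ⁻ κ⁺ y¹ (v (inject₁ s)) → Free κ⁻ κ⁺ y¹ (v (inject₁ s')) → s ≡ s')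

{-# OPTIONS --safe #-}
module Submission where

-- Write y¹ and y² as assignments a and b of items to clusters; item j is moved when a j ≢ b j,
-- and the moved items are the edges a j → b j of CDG(y¹,y²).  Moving exactly the items of a set
-- T of moved items gives cluster sizes |σ_u| = |a_u| − #{j ∈ T : a j = u} + #{j ∈ T : b j = u}.
--
-- Edge ⇒ indecomposable: if c exposes the edge and the CDG splits into valid parts y^p, the moves
-- y^p − y¹ add up to y² − y¹, so Σ_p c·(y^p − y¹) = c·(y² − y¹) = 0 although every term is negative.
--
-- Path or cycle ⇒ edge: a vertex z ∉ {y¹, y²} keeping every item j in {a j, b j} moves some but
-- not all moved items, so along the path or cycle it switches between moved and unmoved edges at
-- a non-free node that the CDG enters and leaves exactly once; there z changes the size of a
-- cluster that is at a bound in both y¹ and y².  Hence the functional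
-- Σ_u φ_u |z_u| − #{j : z puts j outside {a j, b j}}, with φ_u = +1 (−1) on clusters at their
-- upper (lower) bound in both y¹ and y², is maximal exactly at y¹ and y².
--
-- Indecomposable ⇒ path or cycle: follow moved items from a shrinking cluster (from the source
-- of any moved item if no cluster shrinks) until a cycle closes or the walk gets stuck (at a
-- growing cluster).  If this trail misses a moved item, or has a free interior node (path) or two
-- free nodes (cycle), then moving the items of one segment of it, and separately all other moved
-- items, gives two vertices that decompose the CDG.

open import Defs
open import Data.Nat using (ℕ)
open import Data.Fin using (Fin)
open import Data.Product using (_×_)
open import Data.Sum using (_⊎_)
open import Relation.Nullary using (¬_)
open import Function.Bundles using (_⇔_)

open import Level using (0ℓ)
open import Data.Bool using (if_then_else_)
open import Data.Empty using (⊥; ⊥-elim)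
open import Data.Nat using (zero; suc; pred; _+_; _*_; _∸_; _≤_; _<_; z≤n; s≤s)
import Data.Nat.Properties as ℕ
open import Data.Integer as ℤ using (ℤ; +_)
import Data.Integer.Properties as ℤ
open import Data.Fin as Fin using (zero; suc; toℕ; fromℕ; fromℕ<; inject₁)
import Data.Fin.Properties as Fin
open import Data.Product using (∃; _,_; proj₁; proj₂; uncurry)
open import Data.Sum using (inj₁; inj₂; [_,_]′)
open import Function.Base using (id; _∘_)
open import Function.Bundles using (mk⇔; Equivalence)
open import Relation.Binary.Definitions using (tri<; tri≈; tri>)
open import Relation.Binary.PropositionalEquality
open import Relation.Nullary using (Dec; yes; no; ¬?; does)
open import Relation.Nullary.Decidable using (decidable-stable; _⊎-dec_; _×-dec_)
open import Relation.Unary using (Pred; Decidable)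
import Algebra.Properties.CommutativeMonoid.Sum as MonoidSum
import Algebra.Properties.Semiring.Sum as SemiringSum
open import Algebra.Properties.Ring ℤ.+-*-ring using (x[y-z]≈xy-xz; [y-z]x≈yx-zx)

open Equivalence using (to; from)

module ℕΣ = MonoidSum ℕ.+-0-commutativeMonoid
module ℤΣ = SemiringSum ℤ.+-*-semiring

Σℕ≡sum : ∀ {n} (f : Fin n → ℕ) → Σℕ f ≡ ℕΣ.sum f
Σℕ≡sum {zero}  f = refl
Σℕ≡sum {suc n} f = cong (_+_ (f zero)) (Σℕ≡sum (f ∘ suc))

Σℤ≡sum : ∀ {n} (f : Fin n → ℤ) → Σℤ f ≡ ℤΣ.sum f
Σℤ≡sum {zero}  f = refl
Σℤ≡sum {suc n} f = cong (ℤ._+_ (f zero)) (Σℤ≡sum (f ∘ suc))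

Σℕ-cong : ∀ {n} {f g : Fin n → ℕ} → (∀ j → f j ≡ g j) → Σℕ f ≡ Σℕ g
Σℕ-cong {zero}  f≗g = refl
Σℕ-cong {suc n} f≗g = cong₂ _+_ (f≗g zero) (Σℕ-cong (f≗g ∘ suc))

Σℕ-+ : ∀ {n} (f g : Fin n → ℕ) → Σℕ (λ j → f j + g j) ≡ Σℕ f + Σℕ g
Σℕ-+ f g = begin
  Σℕ (λ j → f j + g j)        ≡⟨ Σℕ≡sum (λ j → f j + g j) ⟩
  ℕΣ.sum (λ j → f j + g j)    ≡⟨ ℕΣ.∑-distrib-+ f g ⟩
  ℕΣ.sum f + ℕΣ.sum g         ≡⟨ cong₂ _+_ (Σℕ≡sum f) (Σℕ≡sum g) ⟨
  Σℕ f + Σℕ g                 ∎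
  where open ≡-Reasoning

Σℕ-comm : ∀ {m n} (f : Fin m → Fin n → ℕ) →
  Σℕ (λ i → Σℕ (λ j → f i j)) ≡ Σℕ (λ j → Σℕ (λ i → f i j))
Σℕ-comm f = begin
  Σℕ (λ i → Σℕ (f i))                    ≡⟨ Σℕ²≡sum² f ⟩
  ℕΣ.sum (λ i → ℕΣ.sum (f i))            ≡⟨ ℕΣ.∑-comm f ⟩
  ℕΣ.sum (λ j → ℕΣ.sum (λ i → f i j))    ≡⟨ Σℕ²≡sum² (λ j i → f i j) ⟨
  Σℕ (λ j → Σℕ (λ i → f i j))            ∎
  where
  open ≡-Reasoning
  Σℕ²≡sum² : ∀ {m n} (g : Fin m → Fin n → ℕ) → Σℕ (λ i → Σℕ (g i)) ≡ ℕΣ.sum (λ i → ℕΣ.sum (g i))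
  Σℕ²≡sum² g = trans (Σℕ-cong (λ i → Σℕ≡sum (g i))) (Σℕ≡sum (λ i → ℕΣ.sum (g i)))

Σℕ-zero : ∀ {n} {f : Fin n → ℕ} → (∀ j → f j ≡ 0) → Σℕ f ≡ 0
Σℕ-zero {zero}  f≗0 = refl
Σℕ-zero {suc n} f≗0 = cong₂ _+_ (f≗0 zero) (Σℕ-zero (f≗0 ∘ suc))

Σℕ-single : ∀ {n} {f : Fin n → ℕ} j₀ → (∀ j → j ≢ j₀ → f j ≡ 0) → Σℕ f ≡ f j₀
Σℕ-single {suc n} {f} zero     f≗0 =
  trans (cong (_+_ (f zero)) (Σℕ-zero (λ j → f≗0 (suc j) (λ ())))) (ℕ.+-identityʳ (f zero))
Σℕ-single {suc n} {f} (suc j₀) f≗0 =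
  cong₂ _+_ (f≗0 zero (λ ())) (Σℕ-single j₀ (λ j j≢j₀ → f≗0 (suc j) (j≢j₀ ∘ Fin.suc-injective)))

Σℕ-mono-≤ : ∀ {n} {f g : Fin n → ℕ} → (∀ j → f j ≤ g j) → Σℕ f ≤ Σℕ g
Σℕ-mono-≤ {zero}  f≤g = z≤n
Σℕ-mono-≤ {suc n} f≤g = ℕ.+-mono-≤ (f≤g zero) (Σℕ-mono-≤ (f≤g ∘ suc))

Σℕ-mono-< : ∀ {n} {f g : Fin n → ℕ} → (∀ j → f j ≤ g j) → ∀ j₀ → f j₀ < g j₀ → Σℕ f < Σℕ g
Σℕ-mono-< {suc n} f≤g zero     f<g = ℕ.+-mono-<-≤ f<g (Σℕ-mono-≤ (f≤g ∘ suc))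
Σℕ-mono-< {suc n} f≤g (suc j₀) f<g = ℕ.+-mono-≤-< (f≤g zero) (Σℕ-mono-< (f≤g ∘ suc) j₀ f<g)

Σℕ-≥-term : ∀ {n} (f : Fin n → ℕ) j → f j ≤ Σℕ f
Σℕ-≥-term f zero    = ℕ.m≤m+n (f zero) _
Σℕ-≥-term f (suc j) = ℕ.≤-trans (Σℕ-≥-term (f ∘ suc) j) (ℕ.m≤n+m _ (f zero))

Σℕ≢0⇒∃≢0 : ∀ {n} (f : Fin n → ℕ) → Σℕ f ≢ 0 → ∃ λ j → f j ≢ 0
Σℕ≢0⇒∃≢0 f Σf≢0 with Fin.any? (λ j → ¬? (f j ℕ.≟ 0))
... | yes ∃f≢0 = ∃f≢0
... | no ∄f≢0  = ⊥-elim (Σf≢0 (Σℕ-zero (λ j → decidable-stable (f j ℕ.≟ 0) (λ fj≢0 → ∄f≢0 (j , fj≢0)))))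

Σℤ-cong : ∀ {n} {f g : Fin n → ℤ} → (∀ j → f j ≡ g j) → Σℤ f ≡ Σℤ g
Σℤ-cong {zero}  f≗g = refl
Σℤ-cong {suc n} f≗g = cong₂ ℤ._+_ (f≗g zero) (Σℤ-cong (f≗g ∘ suc))

Σℤ-+ : ∀ {n} (f g : Fin n → ℤ) → Σℤ (λ j → f j ℤ.+ g j) ≡ Σℤ f ℤ.+ Σℤ g
Σℤ-+ f g = begin
  Σℤ (λ j → f j ℤ.+ g j)        ≡⟨ Σℤ≡sum (λ j → f j ℤ.+ g j) ⟩
  ℤΣ.sum (λ j → f j ℤ.+ g j)    ≡⟨ ℤΣ.∑-distrib-+ f g ⟩
  ℤΣ.sum f ℤ.+ ℤΣ.sum g         ≡⟨ cong₂ ℤ._+_ (Σℤ≡sum f) (Σℤ≡sum g) ⟨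
  Σℤ f ℤ.+ Σℤ g                 ∎
  where open ≡-Reasoning

Σℤ-*ˡ : ∀ {n} x (f : Fin n → ℤ) → Σℤ (λ j → x ℤ.* f j) ≡ x ℤ.* Σℤ f
Σℤ-*ˡ x f = begin
  Σℤ (λ j → x ℤ.* f j)        ≡⟨ Σℤ≡sum (λ j → x ℤ.* f j) ⟩
  ℤΣ.sum (λ j → x ℤ.* f j)    ≡⟨ ℤΣ.*-distribˡ-sum x f ⟨
  x ℤ.* ℤΣ.sum f              ≡⟨ cong (x ℤ.*_) (Σℤ≡sum f) ⟨
  x ℤ.* Σℤ f                  ∎
  where open ≡-Reasoning

Σℤ-neg : ∀ {n} (f : Fin n → ℤ) → Σℤ (λ j → ℤ.- f j) ≡ ℤ.- Σℤ f
Σℤ-neg f = begin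
  Σℤ (λ j → ℤ.- f j)            ≡⟨ Σℤ-cong (λ j → ℤ.-1*i≡-i (f j)) ⟨
  Σℤ (λ j → ℤ.-1ℤ ℤ.* f j)      ≡⟨ Σℤ-*ˡ ℤ.-1ℤ f ⟩
  ℤ.-1ℤ ℤ.* Σℤ f                ≡⟨ ℤ.-1*i≡-i (Σℤ f) ⟩
  ℤ.- Σℤ f                      ∎
  where open ≡-Reasoning

Σℤ-- : ∀ {n} (f g : Fin n → ℤ) → Σℤ (λ j → f j ℤ.- g j) ≡ Σℤ f ℤ.- Σℤ g
Σℤ-- f g = trans (Σℤ-+ f (λ j → ℤ.- g j)) (cong (ℤ._+_ (Σℤ f)) (Σℤ-neg g))

Σℤ-comm : ∀ {m n} (f : Fin m → Fin n → ℤ) →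
  Σℤ (λ i → Σℤ (λ j → f i j)) ≡ Σℤ (λ j → Σℤ (λ i → f i j))
Σℤ-comm f = begin
  Σℤ (λ i → Σℤ (f i))                    ≡⟨ Σℤ²≡sum² f ⟩
  ℤΣ.sum (λ i → ℤΣ.sum (f i))            ≡⟨ ℤΣ.∑-comm f ⟩
  ℤΣ.sum (λ j → ℤΣ.sum (λ i → f i j))    ≡⟨ Σℤ²≡sum² (λ j i → f i j) ⟨
  Σℤ (λ j → Σℤ (λ i → f i j))            ∎
  where
  open ≡-Reasoning
  Σℤ²≡sum² : ∀ {m n} (g : Fin m → Fin n → ℤ) → Σℤ (λ i → Σℤ (g i)) ≡ ℤΣ.sum (λ i → ℤΣ.sum (g i))
  Σℤ²≡sum² g = trans (Σℤ-cong (λ i → Σℤ≡sum (g i))) (Σℤ≡sum (λ i → ℤΣ.sum (g i)))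

Σℤ-pos : ∀ {n} (f : Fin n → ℕ) → Σℤ (λ j → + f j) ≡ + Σℕ f
Σℤ-pos {zero}  f = refl
Σℤ-pos {suc n} f = trans (cong (ℤ._+_ (+ f zero)) (Σℤ-pos (f ∘ suc))) (sym (ℤ.pos-+ (f zero) (Σℕ (f ∘ suc))))

Σℤ-zero : ∀ {n} {f : Fin n → ℤ} → (∀ j → f j ≡ + 0) → Σℤ f ≡ + 0
Σℤ-zero {zero}  f≗0 = refl
Σℤ-zero {suc n} f≗0 = cong₂ ℤ._+_ (f≗0 zero) (Σℤ-zero (f≗0 ∘ suc))

Σℤ-single : ∀ {n} {f : Fin n → ℤ} j₀ → (∀ j → j ≢ j₀ → f j ≡ + 0) → Σℤ f ≡ f j₀
Σℤ-single {suc n} {f} zero     f≗0 =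
  trans (cong (ℤ._+_ (f zero)) (Σℤ-zero (λ j → f≗0 (suc j) (λ ())))) (ℤ.+-identityʳ (f zero))
Σℤ-single {suc n} {f} (suc j₀) f≗0 =
  trans (cong₂ ℤ._+_ (f≗0 zero (λ ())) (Σℤ-single j₀ (λ j j≢j₀ → f≗0 (suc j) (j≢j₀ ∘ Fin.suc-injective))))
        (ℤ.+-identityˡ (f (suc j₀)))

Σℤ-mono-≤ : ∀ {n} {f g : Fin n → ℤ} → (∀ j → f j ℤ.≤ g j) → Σℤ f ℤ.≤ Σℤ g
Σℤ-mono-≤ {zero}  f≤g = ℤ.≤-refl
Σℤ-mono-≤ {suc n} f≤g = ℤ.+-mono-≤ (f≤g zero) (Σℤ-mono-≤ (f≤g ∘ suc))

Σℤ-mono-< : ∀ {n} {f g : Fin n → ℤ} → (∀ j → f j ℤ.≤ g j) → ∀ j₀ → f j₀ ℤ.< g j₀ → Σℤ f ℤ.< Σℤ g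
Σℤ-mono-< {suc n} f≤g zero     f<g = ℤ.+-mono-<-≤ f<g (Σℤ-mono-≤ (f≤g ∘ suc))
Σℤ-mono-< {suc n} f≤g (suc j₀) f<g = ℤ.+-mono-≤-< (f≤g zero) (Σℤ-mono-< (f≤g ∘ suc) j₀ f<g)

-- Clusterings as assignments

𝟙 : ∀ {p} {P : Set p} → Dec P → ℕ
𝟙 (yes _) = 1
𝟙 (no _)  = 0

𝟙-yes : ∀ {p} {P : Set p} (P? : Dec P) → P → 𝟙 P? ≡ 1
𝟙-yes (yes _) _  = refl
𝟙-yes (no ¬p) p  = ⊥-elim (¬p p)

𝟙-no : ∀ {p} {P : Set p} (P? : Dec P) → ¬ P → 𝟙 P? ≡ 0
𝟙-no (yes p) ¬p = ⊥-elim (¬p p)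
𝟙-no (no _)  _  = refl

𝟙≡1⇒ : ∀ {p} {P : Set p} (P? : Dec P) → 𝟙 P? ≡ 1 → P
𝟙≡1⇒ (yes p) _ = p

𝟙≤1 : ∀ {p} {P : Set p} (P? : Dec P) → 𝟙 P? ≤ 1
𝟙≤1 (yes _) = ℕ.≤-refl
𝟙≤1 (no _)  = z≤n

δ : ∀ {k} → Fin k → Fin k → ℕ
δ x y = 𝟙 (x Fin.≟ y)

δ-refl : ∀ {k} (x : Fin k) → δ x x ≡ 1
δ-refl x = 𝟙-yes (x Fin.≟ x) refl

δ-≢ : ∀ {k} {x y : Fin k} → x ≢ y → δ x y ≡ 0
δ-≢ {x = x} {y} = 𝟙-no (x Fin.≟ y)

δ-≡ : ∀ {k} {x y : Fin k} → x ≡ y → δ x y ≡ 1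
δ-≡ {x = x} refl = δ-refl x

δ≡1⇒≡ : ∀ {k} {x y : Fin k} → δ x y ≡ 1 → x ≡ y
δ≡1⇒≡ {x = x} {y} = 𝟙≡1⇒ (x Fin.≟ y)

pt : ∀ {k n} → (Fin n → Fin k) → Pt k n
pt σ i j = δ i (σ j)

δ-column : ∀ {k n} (σ : Fin n → Fin k) j → Σℕ (λ i → δ i (σ j)) ≡ 1
δ-column σ j = trans (Σℕ-single (σ j) (λ _ → δ-≢)) (δ-refl (σ j))

unit-column : ∀ {k} (f : Fin k → ℕ) → (∀ i → f i ≤ 1) → Σℕ f ≡ 1 → ∃ λ i₀ → ∀ i → f i ≡ δ i i₀
unit-column f f≤1 Σf≡1 = i₀ , column
  where
  nonzero = Σℕ≢0⇒∃≢0 f (λ Σf≡0 → ℕ.1+n≢0 (trans (sym Σf≡1) Σf≡0))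
  i₀ = proj₁ nonzero
  fi₀≡1 : f i₀ ≡ 1
  fi₀≡1 = ℕ.≤-antisym (f≤1 i₀) (ℕ.n≢0⇒n>0 (proj₂ nonzero))
  δ≤f : ∀ i → δ i i₀ ≤ f i
  δ≤f i with i Fin.≟ i₀
  ... | yes refl = ℕ.≤-reflexive (sym fi₀≡1)
  ... | no _     = z≤n
  column : ∀ i → f i ≡ δ i i₀
  column i with i Fin.≟ i₀ | f i ℕ.≟ 0
  ... | yes refl | _        = fi₀≡1
  ... | no _     | yes fi≡0 = fi≡0
  ... | no i≢i₀  | no fi≢0  = ⊥-elim (ℕ.<-irrefl Σδ≡Σf (Σℕ-mono-< δ≤f i δi<fi))
    where
    δi<fi : δ i i₀ < f i
    δi<fi = subst (_< f i) (sym (δ-≢ i≢i₀)) (ℕ.n≢0⇒n>0 fi≢0)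
    Σδ≡Σf : Σℕ (λ i → δ i i₀) ≡ Σℕ f
    Σδ≡Σf = trans (Σℕ-single i₀ (λ _ → δ-≢)) (trans (δ-refl i₀) (sym Σf≡1))

size-≐ : ∀ {k n} {y z : Pt k n} → y ≐ z → ∀ u → size y u ≡ size z u
size-≐ y≐z u = Σℕ-cong (y≐z u)

total-size : ∀ {k n} (σ τ : Fin n → Fin k) → Σℕ (size (pt σ)) ≡ Σℕ (size (pt τ))
total-size σ τ = begin
  Σℕ (λ u → Σℕ (λ j → δ u (σ j)))   ≡⟨ Σℕ-comm (λ u j → δ u (σ j)) ⟩
  Σℕ (λ j → Σℕ (λ u → δ u (σ j)))   ≡⟨ Σℕ-cong (λ j → trans (δ-column σ j) (sym (δ-column τ j))) ⟩
  Σℕ (λ j → Σℕ (λ u → δ u (τ j)))   ≡⟨ Σℕ-comm (λ u j → δ u (τ j)) ⟨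
  Σℕ (λ u → Σℕ (λ j → δ u (τ j)))   ∎
  where open ≡-Reasoning

Feasible : ∀ {k n} (κ⁻ κ⁺ : Fin k → ℕ) → (Fin n → Fin k) → Set
Feasible κ⁻ κ⁺ σ = ∀ u → κ⁻ u ≤ size (pt σ) u × size (pt σ) u ≤ κ⁺ u

Free? : ∀ {k n} (κ⁻ κ⁺ : Fin k → ℕ) (y : Pt k n) → Decidable (Free κ⁻ κ⁺ y)
Free? κ⁻ κ⁺ y u = (κ⁻ u ℕ.<? size y u) ×-dec (size y u ℕ.<? κ⁺ u)

module _ {k n : ℕ} {κ⁻ κ⁺ : Fin k → ℕ} where

  assignment : ∀ {y : Pt k n} → IsVertex κ⁻ κ⁺ y → ∃ λ σ → y ≐ pt σ
  assignment {y} (y≤1 , column≡1 , _) =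
    (λ j → proj₁ (column j)) , (λ i j → proj₂ (column j) i)
    where column = λ j → unit-column (λ i → y i j) (λ i → y≤1 i j) (column≡1 j)

  vertex-feasible : ∀ {y} {σ : Fin n → Fin k} → IsVertex κ⁻ κ⁺ y → y ≐ pt σ → Feasible κ⁻ κ⁺ σ
  vertex-feasible (_ , _ , bounds) y≐σ u = subst (λ s → κ⁻ u ≤ s × s ≤ κ⁺ u) (size-≐ y≐σ u) (bounds u)

  feasible-vertex : ∀ {σ : Fin n → Fin k} → Feasible κ⁻ κ⁺ σ → IsVertex κ⁻ κ⁺ (pt σ)
  feasible-vertex {σ} feasible = (λ i j → 𝟙≤1 (i Fin.≟ σ j)) , δ-column σ , feasible

-- Moving a set of items

module _ {k n : ℕ} {t} {T : Pred (Fin n) t} (T? : Decidable T) where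

  override : (Fin n → Fin k) → (Fin n → Fin k) → Fin n → Fin k
  override a b j = if does (T? j) then b j else a j

  override-≡ : ∀ {a b : Fin n → Fin k} {x} j → (T j → b j ≡ x) → (¬ T j → a j ≡ x) → override a b j ≡ x
  override-≡ j in-T not-in-T with T? j
  ... | yes j∈T = in-T j∈T
  ... | no j∉T  = not-in-T j∉T

  override-∈ : ∀ {a b : Fin n → Fin k} j → T j → override a b j ≡ b j
  override-∈ {a} {b} j j∈T = override-≡ {a} {b} j (λ _ → refl) (λ j∉T → ⊥-elim (j∉T j∈T))

  override-∉ : ∀ {a b : Fin n → Fin k} j → ¬ T j → override a b j ≡ a j
  override-∉ {a} {b} j j∉T = override-≡ {a} {b} j (λ j∈T → ⊥-elim (j∉T j∈T)) (λ _ → refl)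

  hits : (Fin n → Fin k) → Fin k → ℕ
  hits g u = Σℕ (λ j → 𝟙 (T? j) * δ u (g j))

  size-override : ∀ a b u → size (pt (override a b)) u + hits a u ≡ size (pt a) u + hits b u
  size-override a b u = begin
    size (pt (override a b)) u + hits a u
      ≡⟨ Σℕ-+ (λ j → δ u (override a b j)) (λ j → 𝟙 (T? j) * δ u (a j)) ⟨
    Σℕ (λ j → δ u (override a b j) + 𝟙 (T? j) * δ u (a j))
      ≡⟨ Σℕ-cong exchange ⟩
    Σℕ (λ j → δ u (a j) + 𝟙 (T? j) * δ u (b j))
      ≡⟨ Σℕ-+ (λ j → δ u (a j)) (λ j → 𝟙 (T? j) * δ u (b j)) ⟩
    size (pt a) u + hits b u
      ∎
    where
    open ≡-Reasoning
    exchange : ∀ j → δ u (override a b j) + 𝟙 (T? j) * δ u (a j) ≡ δ u (a j) + 𝟙 (T? j) * δ u (b j)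
    exchange j with T? j
    ... | yes _ = trans (ℕ.+-comm (δ u (b j)) (1 * δ u (a j)))
                        (cong₂ _+_ (ℕ.*-identityˡ (δ u (a j))) (sym (ℕ.*-identityˡ (δ u (b j)))))
    ... | no _  = refl

  hits-none : ∀ {g u} → (∀ j → T j → g j ≢ u) → hits g u ≡ 0
  hits-none {g} {u} missing = Σℕ-zero zero-at
    where
    zero-at : ∀ j → 𝟙 (T? j) * δ u (g j) ≡ 0
    zero-at j with T? j
    ... | yes t = trans (ℕ.+-identityʳ (δ u (g j))) (δ-≢ (missing j t ∘ sym))
    ... | no _  = refl

  hits-single : ∀ {g u} j₀ → g j₀ ≡ u → (∀ j → T j → g j ≡ u → j ≡ j₀) → hits g u ≡ 𝟙 (T? j₀)
  hits-single {g} {u} j₀ refl unique = trans (Σℕ-single j₀ zero-off) at-j₀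
    where
    zero-off : ∀ j → j ≢ j₀ → 𝟙 (T? j) * δ (g j₀) (g j) ≡ 0
    zero-off j j≢j₀ with T? j
    ... | yes t = trans (ℕ.+-identityʳ _) (δ-≢ (λ e → j≢j₀ (unique j t (sym e))))
    ... | no _  = refl
    at-j₀ : 𝟙 (T? j₀) * δ (g j₀) (g j₀) ≡ 𝟙 (T? j₀)
    at-j₀ = trans (cong (𝟙 (T? j₀) *_) (δ-refl (g j₀))) (ℕ.*-identityʳ _)

  hits-positive : ∀ {g u} j₀ → T j₀ → g j₀ ≡ u → 1 ≤ hits g u
  hits-positive {g} {u} j₀ j₀∈T refl =
    ℕ.≤-trans (ℕ.≤-reflexive (sym at-j₀)) (Σℕ-≥-term (λ j → 𝟙 (T? j) * δ (g j₀) (g j)) j₀)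
    where
    at-j₀ : 𝟙 (T? j₀) * δ (g j₀) (g j₀) ≡ 1
    at-j₀ = cong₂ _*_ (𝟙-yes (T? j₀) j₀∈T) (δ-refl (g j₀))

  hits≢0 : ∀ {g u} → hits g u ≢ 0 → ∃ λ j → T j × g j ≡ u
  hits≢0 {g} {u} nonzero with Σℕ≢0⇒∃≢0 (λ j → 𝟙 (T? j) * δ u (g j)) nonzero
  ... | j , term≢0 with T? j | u Fin.≟ g j
  ...   | yes j∈T | yes u≡gj = j , j∈T , sym u≡gj
  ...   | yes _   | no _     = ⊥-elim (term≢0 refl)
  ...   | no _    | _        = ⊥-elim (term≢0 refl)

module _ {k n : ℕ} {y z : Pt k n} {σ τ : Fin n → Fin k} (y≐σ : y ≐ pt σ) (z≐τ : z ≐ pt τ) where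

  CDG-ends : ∀ {i ℓ j} → CDG y z i ℓ j → i ≡ σ j × ℓ ≡ τ j
  CDG-ends {i} {ℓ} {j} (yij≡1 , zℓj≡1 , _) =
    δ≡1⇒≡ (trans (sym (y≐σ i j)) yij≡1) , δ≡1⇒≡ (trans (sym (z≐τ ℓ j)) zℓj≡1)

  CDG-moved : ∀ {j} → σ j ≢ τ j → CDG y z (σ j) (τ j) j
  CDG-moved {j} σj≢τj = trans (y≐σ (σ j) j) (δ-refl (σ j)) , trans (z≐τ (τ j) j) (δ-refl (τ j)) , σj≢τj

single-edge-path : ∀ {k n} {κ⁻ κ⁺ : Fin k → ℕ} {y : Pt k n} {D : LGraph k n} →
  (∀ {i ℓ j} → D i ℓ j → i ≢ ℓ) → SingleEdge D → PathNoFreeInterior κ⁻ κ⁺ y D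
single-edge-path {k} {n} {D = D} loopless (i , ℓ , j , edge , unique) =
  1 , v , (λ _ → j) , s≤s z≤n , injective , edges , λ { (suc zero) _ (s≤s ()) }
  where
  v : Fin 2 → Fin k
  v zero    = i
  v (suc _) = ℓ
  injective : ∀ s s′ → v s ≡ v s′ → s ≡ s′
  injective zero       zero       _   = refl
  injective zero       (suc zero) i≡ℓ = ⊥-elim (loopless edge i≡ℓ)
  injective (suc zero) zero       ℓ≡i = ⊥-elim (loopless edge (sym ℓ≡i))
  injective (suc zero) (suc zero) _   = refl
  edges : WalkEdges D v (λ _ → j)
  edges i′ ℓ′ j′ = mk⇔ (λ e → let (i′≡i , ℓ′≡ℓ , j′≡j) = unique i′ ℓ′ j′ e in zero , i′≡i , ℓ′≡ℓ , j′≡j)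
                       (λ { (zero , refl , refl , refl) → edge })

module _ {k n : ℕ} (c : Fin k → Fin n → ℤ) where

  dot-− : ∀ (y z : Pt k n) →
    dot c y ℤ.- dot c z ≡ Σℤ (λ i → Σℤ (λ j → c i j ℤ.* (+ y i j ℤ.- + z i j)))
  dot-− y z = begin
    dot c y ℤ.- dot c z
      ≡⟨ Σℤ-- (λ i → Σℤ (λ j → c i j ℤ.* + y i j)) (λ i → Σℤ (λ j → c i j ℤ.* + z i j)) ⟨
    Σℤ (λ i → Σℤ (λ j → c i j ℤ.* + y i j) ℤ.- Σℤ (λ j → c i j ℤ.* + z i j))
      ≡⟨ Σℤ-cong (λ i → Σℤ-- (λ j → c i j ℤ.* + y i j) (λ j → c i j ℤ.* + z i j)) ⟨
    Σℤ (λ i → Σℤ (λ j → c i j ℤ.* + y i j ℤ.- c i j ℤ.* + z i j))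
      ≡⟨ Σℤ-cong (λ i → Σℤ-cong (λ j → x[y-z]≈xy-xz (c i j) (+ y i j) (+ z i j))) ⟨
    Σℤ (λ i → Σℤ (λ j → c i j ℤ.* (+ y i j ℤ.- + z i j)))
      ∎
    where open ≡-Reasoning

  dot-superposition : ∀ {m} (ys : Fin m → Pt k n) (z w : Pt k n) →
    (∀ i j → Σℤ (λ p → + ys p i j ℤ.- + z i j) ≡ + w i j ℤ.- + z i j) →
    Σℤ (λ p → dot c (ys p) ℤ.- dot c z) ≡ dot c w ℤ.- dot c z
  dot-superposition ys z w moves-add-up = begin
    Σℤ (λ p → dot c (ys p) ℤ.- dot c z)
      ≡⟨ Σℤ-cong (λ p → dot-− (ys p) z) ⟩
    Σℤ (λ p → Σℤ (λ i → Σℤ (λ j → c i j ℤ.* Δ p i j)))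
      ≡⟨ Σℤ-comm (λ p i → Σℤ (λ j → c i j ℤ.* Δ p i j)) ⟩
    Σℤ (λ i → Σℤ (λ p → Σℤ (λ j → c i j ℤ.* Δ p i j)))
      ≡⟨ Σℤ-cong (λ i → Σℤ-comm (λ p j → c i j ℤ.* Δ p i j)) ⟩
    Σℤ (λ i → Σℤ (λ j → Σℤ (λ p → c i j ℤ.* Δ p i j)))
      ≡⟨ Σℤ-cong (λ i → Σℤ-cong (λ j → Σℤ-*ˡ (c i j) (λ p → Δ p i j))) ⟩
    Σℤ (λ i → Σℤ (λ j → c i j ℤ.* Σℤ (λ p → Δ p i j)))
      ≡⟨ Σℤ-cong (λ i → Σℤ-cong (λ j → cong (c i j ℤ.*_) (moves-add-up i j))) ⟩
    Σℤ (λ i → Σℤ (λ j → c i j ℤ.* (+ w i j ℤ.- + z i j)))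
      ≡⟨ dot-− w z ⟨
    dot c w ℤ.- dot c z
      ∎
    where
    open ≡-Reasoning
    Δ = λ p i j → + ys p i j ℤ.- + z i j

bound-weight : (s s′ lo hi : ℕ) → ℤ
bound-weight s s′ lo hi with s ℕ.≟ s′ | s ℕ.≟ hi | s ℕ.≟ lo
... | yes _ | yes _ | _     = + 1
... | yes _ | no _  | yes _ = ℤ.-1ℤ
... | _     | _     | _     = + 0

module _ (s s′ : ℕ) {lo hi z : ℕ} where

  bound-weight-max : lo ≤ z → z ≤ hi → bound-weight s s′ lo hi ℤ.* + z ℤ.≤ bound-weight s s′ lo hi ℤ.* + s
  bound-weight-max lo≤z z≤hi with s ℕ.≟ s′ | s ℕ.≟ hi | s ℕ.≟ lo
  ... | yes _ | yes refl | _        =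
    subst₂ ℤ._≤_ (sym (ℤ.*-identityˡ (+ z))) (sym (ℤ.*-identityˡ (+ s))) (ℤ.+≤+ z≤hi)
  ... | yes _ | no _     | yes refl =
    subst₂ ℤ._≤_ (sym (ℤ.-1*i≡-i (+ z))) (sym (ℤ.-1*i≡-i (+ s))) (ℤ.neg-mono-≤ (ℤ.+≤+ lo≤z))
  ... | yes _ | no _     | no _     = ℤ.≤-refl
  ... | no _  | _        | _        = ℤ.≤-refl

  bound-weight-strict : s ≡ s′ → s ≡ hi ⊎ s ≡ lo → z ≢ s → lo ≤ z → z ≤ hi →
    bound-weight s s′ lo hi ℤ.* + z ℤ.< bound-weight s s′ lo hi ℤ.* + s
  bound-weight-strict s≡s′ at-bound z≢s lo≤z z≤hi with s ℕ.≟ s′ | s ℕ.≟ hi | s ℕ.≟ lo | at-bound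
  ... | no s≢s′ | _        | _        | _         = ⊥-elim (s≢s′ s≡s′)
  ... | yes _   | yes refl | _        | _         =
    subst₂ ℤ._<_ (sym (ℤ.*-identityˡ (+ z))) (sym (ℤ.*-identityˡ (+ s))) (ℤ.+<+ (ℕ.≤∧≢⇒< z≤hi z≢s))
  ... | yes _   | no _     | yes refl | _         =
    subst₂ ℤ._<_ (sym (ℤ.-1*i≡-i (+ z))) (sym (ℤ.-1*i≡-i (+ s)))
      (ℤ.neg-mono-< (ℤ.+<+ (ℕ.≤∧≢⇒< lo≤z (z≢s ∘ sym))))
  ... | yes _   | no s≢hi  | no s≢lo  | inj₁ s≡hi = ⊥-elim (s≢hi s≡hi)
  ... | yes _   | no s≢hi  | no s≢lo  | inj₂ s≡lo = ⊥-elim (s≢lo s≡lo)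

bound-weight-balanced : ∀ s s′ lo hi → bound-weight s s′ lo hi ℤ.* + s ≡ bound-weight s s′ lo hi ℤ.* + s′
bound-weight-balanced s s′ lo hi with s ℕ.≟ s′ | s ℕ.≟ hi | s ℕ.≟ lo
... | yes refl | yes _ | _     = refl
... | yes refl | no _  | yes _ = refl
... | yes refl | no _  | no _  = refl
... | no _     | _     | _     = refl

at-bound : ∀ {lo s hi} → lo ≤ s → s ≤ hi → ¬ (lo < s × s < hi) → s ≡ hi ⊎ s ≡ lo
at-bound {lo} {s} {hi} lo≤s s≤hi not-strict with s ℕ.≟ hi | s ℕ.≟ lo
... | yes s≡hi | _        = inj₁ s≡hi
... | no _     | yes s≡lo = inj₂ s≡lo
... | no s≢hi  | no s≢lo  = ⊥-elim (not-strict (ℕ.≤∧≢⇒< lo≤s (s≢lo ∘ sym) , ℕ.≤∧≢⇒< s≤hi s≢hi))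

shifted-bounds : ∀ {p q} {P : Set p} {Q : Set q} (P? : Dec P) (Q? : Dec Q) {x s lo hi : ℕ} →
  x + 𝟙 P? ≡ s + 𝟙 Q? → lo ≤ s → s ≤ hi → (P → ¬ Q → lo < s) → (Q → ¬ P → s < hi) → lo ≤ x × x ≤ hi
shifted-bounds (yes _) (yes _) {x} {s} eq lo≤s s≤hi _ _ =
  subst (λ t → _ ≤ t × t ≤ _) (sym (ℕ.+-cancelʳ-≡ _ x s eq)) (lo≤s , s≤hi)
shifted-bounds (no _)  (no _)  {x} {s} eq lo≤s s≤hi _ _ =
  subst (λ t → _ ≤ t × t ≤ _) (sym (ℕ.+-cancelʳ-≡ _ x s eq)) (lo≤s , s≤hi)
shifted-bounds (yes p) (no ¬q) {x} {s} eq lo≤s s≤hi lo<s _ =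
  ℕ.≤-pred (subst (_ <_) (sym 1+x≡s) (lo<s p ¬q)) , ℕ.≤-trans (ℕ.n≤1+n x) (subst (_≤ _) (sym 1+x≡s) s≤hi)
  where 1+x≡s = trans (ℕ.+-comm 1 x) (trans eq (ℕ.+-identityʳ s))
shifted-bounds (no ¬p) (yes q) {x} {s} eq lo≤s s≤hi _ s<hi =
  ℕ.≤-trans lo≤s (subst (s ≤_) (sym x≡1+s) (ℕ.n≤1+n s)) , subst (_≤ _) (sym x≡1+s) (s<hi q ¬p)
  where x≡1+s = trans (sym (ℕ.+-identityʳ x)) (trans eq (ℕ.+-comm s 1))

another : ∀ {m} → 2 ≤ m → (p : Fin m) → ∃ λ q → q ≢ p
another (s≤s (s≤s _)) p = Fin.punchIn p zero , Fin.punchInᵢ≢i p zero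

pred<self : ∀ {r} → 0 < r → pred r < r
pred<self {suc l} _ = ℕ.n<1+n l

suc-pred : ∀ {r} → 0 < r → suc (pred r) ≡ r
suc-pred {suc l} _ = refl

shift< : ∀ α {r t} → t < r ∸ α → α + t < r
shift< zero    t<r = t<r
shift< (suc α) {suc r} t<r = s≤s (shift< α t<r)

least : ∀ {p} {P : ℕ → Set p} → Decidable P → ∀ n → (∃ λ q → q < n × P q) →
  ∃ λ m → P m × (∀ {m′} → m′ < m → ¬ P m′)
least P? (suc n) witness with ℕ.anyUpTo? P? n
... | yes earlier = least P? n earlier
... | no none with witness
...   | q , s≤s q≤n , Pq with ℕ.m≤n⇒m<n∨m≡n q≤n
...     | inj₁ q<n  = ⊥-elim (none (q , q<n , Pq))
...     | inj₂ refl = q , Pq , λ m′<q Pm′ → none (_ , m′<q , Pm′)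

step-change : (f : ℕ → ℕ) → ∀ {i j} → i ≤ j → f i ≢ f j → ∃ λ s → i ≤ s × s < j × f s ≢ f (suc s)
step-change f {j = zero}  z≤n   fi≢fj = ⊥-elim (fi≢fj refl)
step-change f {i} {suc j} i≤1+j fi≢fj with ℕ.≤∧≢⇒< i≤1+j (λ i≡1+j → fi≢fj (cong f i≡1+j)) | f j ℕ.≟ f (suc j)
... | s≤s i≤j | no jump  = j , i≤j , ℕ.n<1+n j , jump
... | s≤s i≤j | yes flat with step-change f i≤j (λ fi≡fj → fi≢fj (trans fi≡fj flat))
...   | s , i≤s , s<j , jump = s , i≤s , ℕ.m<n⇒m<1+n s<j , jump

inner-change : (f : ℕ → ℕ) → ∀ {r t₀ t₁} → t₀ < r → t₁ < r → f t₀ ≢ f t₁ → ∃ λ s → suc s < r × f s ≢ f (suc s)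
inner-change f {t₀ = t₀} {t₁} t₀<r t₁<r f₀≢f₁ with ℕ.≤-total t₀ t₁
... | inj₁ t₀≤t₁ with step-change f t₀≤t₁ f₀≢f₁
...   | s , _ , s<t₁ , jump = s , ℕ.<-≤-trans (s≤s s<t₁) t₁<r , jump
inner-change f t₀<r t₁<r f₀≢f₁ | inj₂ t₁≤t₀ with step-change f t₁≤t₀ (f₀≢f₁ ∘ sym)
...   | s , _ , s<t₀ , jump = s , ℕ.<-≤-trans (s≤s s<t₀) t₀<r , jump

CyclicChange : (ℕ → ℕ) → ℕ → ℕ → Set
CyclicChange f r e = (∃ λ s → suc s < r × suc s ≢ e × f s ≢ f (suc s)) ⊎ (0 ≢ e × f (pred r) ≢ f 0)

cyclic-change : (f : ℕ → ℕ) → ∀ {r e t₀ t₁} → e < r → t₀ < r → t₁ < r → f t₀ ≢ f t₁ → CyclicChange f r e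
cyclic-change f {suc l} {e} {t₀} {t₁} (s≤s e≤l) t₀<r t₁<r f₀≢f₁
  with f e ℕ.≟ f l | f l ℕ.≟ f 0
... | no fe≢fl | _ with step-change f e≤l fe≢fl
...   | s , e≤s , s<l , jump = inj₁ (s , s≤s s<l , (λ 1+s≡e → ℕ.<-irrefl (sym 1+s≡e) (s≤s e≤s)) , jump)
cyclic-change f {suc l} {e} (s≤s e≤l) t₀<r t₁<r f₀≢f₁ | yes fe≡fl | no fl≢f0 =
  inj₂ ((λ { refl → fl≢f0 (sym fe≡fl) }) , fl≢f0)
cyclic-change f {suc l} {e} {t₀} {t₁} (s≤s e≤l) t₀<r t₁<r f₀≢f₁ | yes fe≡fl | yes fl≡f0 =
  away-from-e (differs-from-e (f t₀ ℕ.≟ f e))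
  where
  differs-from-e : Dec (f t₀ ≡ f e) → ∃ λ x → x < suc l × f x ≢ f e
  differs-from-e (yes f₀≡fe) = t₁ , t₁<r , (λ f₁≡fe → f₀≢f₁ (trans f₀≡fe (sym f₁≡fe)))
  differs-from-e (no f₀≢fe)  = t₀ , t₀<r , f₀≢fe
  away-from-e : (∃ λ x → x < suc l × f x ≢ f e) → CyclicChange f (suc l) e
  away-from-e (x , x<r , fx≢fe) with ℕ.<-cmp x e
  ... | tri≈ _ x≡e _ = ⊥-elim (fx≢fe (cong f x≡e))
  ... | tri< x<e _ _ with step-change f z≤n (λ f0≡fx → fx≢fe (trans (sym f0≡fx) (sym (trans fe≡fl fl≡f0))))
  ...   | s , _ , s<x , jump =
    inj₁ (s , ℕ.≤-<-trans s<x x<r , (λ 1+s≡e → ℕ.<-irrefl 1+s≡e (ℕ.≤-<-trans s<x x<e)) , jump)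
  away-from-e (x , x<r , fx≢fe) | tri> _ _ e<x with step-change f (ℕ.<⇒≤ e<x) (fx≢fe ∘ sym)
  ...   | s , e≤s , s<x , jump =
    inj₁ (s , ℕ.≤-<-trans s<x x<r , (λ 1+s≡e → ℕ.<-irrefl (sym 1+s≡e) (s≤s e≤s)) , jump)

clamp : ∀ r → ℕ → Fin (suc r)
clamp r       zero    = zero
clamp zero    (suc t) = zero
clamp (suc r) (suc t) = suc (clamp r t)

toℕ-clamp : ∀ {r t} → t ≤ r → toℕ (clamp r t) ≡ t
toℕ-clamp {r}     {zero}  _         = refl
toℕ-clamp {suc r} {suc t} (s≤s t≤r) = cong suc (toℕ-clamp t≤r)

clamp-toℕ : ∀ {r} (s : Fin (suc r)) → clamp r (toℕ s) ≡ s
clamp-toℕ {r}     zero    = refl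
clamp-toℕ {suc r} (suc s) = cong suc (clamp-toℕ s)

clamp-self : ∀ r → clamp r r ≡ fromℕ r
clamp-self zero    = refl
clamp-self (suc r) = cong suc (clamp-self r)

inject₁-clamp : ∀ {r t} → t ≤ r → inject₁ (clamp r t) ≡ clamp (suc r) t
inject₁-clamp {r}     {zero}  _         = refl
inject₁-clamp {suc r} {suc t} (s≤s t≤r) = cong suc (inject₁-clamp t≤r)

clamp-injective : ∀ {r s t} → s ≤ r → t ≤ r → clamp r s ≡ clamp r t → s ≡ t
clamp-injective s≤r t≤r eq = trans (sym (toℕ-clamp s≤r)) (trans (cong toℕ eq) (toℕ-clamp t≤r))

module VertexPair {k n : ℕ} (κ⁻ κ⁺ : Fin k → ℕ) {y¹ y² : Pt k n}
            (V¹ : IsVertex κ⁻ κ⁺ y¹) (V² : IsVertex κ⁻ κ⁺ y²) where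

  -- Of the chosen assignments only y¹ ≐ pt a and y² ≐ pt b are ever used.
  opaque
    a b : Fin n → Fin k
    a = proj₁ (assignment V¹)
    b = proj₁ (assignment V²)

    y¹≐a : y¹ ≐ pt a
    y¹≐a = proj₂ (assignment V¹)

    y²≐b : y² ≐ pt b
    y²≐b = proj₂ (assignment V²)

  D : LGraph k n
  D = CDG y¹ y²

  ∣a∣ ∣b∣ : Fin k → ℕ
  ∣a∣ = size (pt a)
  ∣b∣ = size (pt b)

  Free¹ : Pred (Fin k) 0ℓ
  Free¹ = Free κ⁻ κ⁺ y¹

  Free¹? : Decidable Free¹
  Free¹? = Free? κ⁻ κ⁺ y¹

  size¹ : ∀ u → size y¹ u ≡ ∣a∣ u
  size¹ = size-≐ y¹≐a

  size² : ∀ u → size y² u ≡ ∣b∣ u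
  size² = size-≐ y²≐b

  a-feasible : Feasible κ⁻ κ⁺ a
  a-feasible = vertex-feasible V¹ y¹≐a

  b-feasible : Feasible κ⁻ κ⁺ b
  b-feasible = vertex-feasible V² y²≐b

  Moved : Pred (Fin n) 0ℓ
  Moved j = a j ≢ b j

  Moved? : Decidable Moved
  Moved? j = ¬? (a j Fin.≟ b j)

  flow : ∀ u → ∣b∣ u + hits Moved? a u ≡ ∣a∣ u + hits Moved? b u
  flow u = trans (cong (_+ hits Moved? a u) (Σℕ-cong (λ j → cong (δ u) (sym (override≗b j))))) (size-override Moved? a b u)
    where
    override≗b : ∀ j → override Moved? a b j ≡ b j
    override≗b j = override-≡ Moved? {a} {b} j (λ _ → refl) (decidable-stable (a j Fin.≟ b j))

  -- Edges are indecomposable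

  module Parts {m} (P : Fin m → LGraph k n)
               (P⊆D : ∀ p i ℓ j → P p i ℓ j → D i ℓ j) (D⊆P : ∀ i ℓ j → D i ℓ j → ∃ λ p → P p i ℓ j)
               (P-disjoint : ∀ p q i ℓ j → P p i ℓ j → P q i ℓ j → p ≡ q)
               (P-valid : ∀ p → ValidCDG κ⁻ κ⁺ y¹ (P p)) where

    y : Fin m → Pt k n
    y p = proj₁ (P-valid p)

    y-vertex : ∀ p → IsVertex κ⁻ κ⁺ (y p)
    y-vertex p = proj₁ (proj₂ (P-valid p))

    P≅ : ∀ p → P p ≅ CDG y¹ (y p)
    P≅ p = proj₂ (proj₂ (P-valid p))

    σ : Fin m → Fin n → Fin k
    σ p = proj₁ (assignment (y-vertex p))

    y≐σ : ∀ p → y p ≐ pt (σ p)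
    y≐σ p = proj₂ (assignment (y-vertex p))

    stays-or-carries : ∀ p j → σ p j ≡ a j ⊎ P p (a j) (b j) j
    stays-or-carries p j with σ p j Fin.≟ a j
    ... | yes stays = inj₁ stays
    ... | no moves  = inj₂ (subst (λ ℓ → P p (a j) ℓ j) (proj₂ (CDG-ends y¹≐a y²≐b (P⊆D p _ _ _ edge))) edge)
      where edge = from (P≅ p _ _ _) (CDG-moved y¹≐a (y≐σ p) (moves ∘ sym))

    part≢y¹ : ∀ p → NonEmpty (P p) → ¬ (y p ≐ y¹)
    part≢y¹ p (i , ℓ , j , e) y≐y¹ with to (P≅ p i ℓ j) e
    ... | edge@(_ , _ , i≢ℓ) with CDG-ends y¹≐a (λ i′ j′ → trans (y≐y¹ i′ j′) (y¹≐a i′ j′)) edge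
    ...   | i≡aj , ℓ≡aj = i≢ℓ (trans i≡aj (sym ℓ≡aj))

    part≢y² : ∀ p q → q ≢ p → NonEmpty (P q) → ¬ (y p ≐ y²)
    part≢y² p q q≢p (i , ℓ , j , e) y≐y² with P⊆D q i ℓ j e
    ... | y¹ij≡1 , y²ℓj≡1 , i≢ℓ =
      q≢p (P-disjoint q p i ℓ j e (from (P≅ p i ℓ j) (y¹ij≡1 , trans (y≐y² ℓ j) y²ℓj≡1 , i≢ℓ)))

    Δ-stays : ∀ {z τ} → z ≐ pt τ → ∀ i {j} → τ j ≡ a j → + z i j ℤ.- + y¹ i j ≡ + 0
    Δ-stays z≐τ i {j} τj≡aj =
      trans (cong (λ s → + s ℤ.- + y¹ i j) (trans (z≐τ i j) (trans (cong (δ i) τj≡aj) (sym (y¹≐a i j)))))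
            (ℤ.+-inverseʳ (+ y¹ i j))

    parts-add-up : ∀ i j → Σℤ (λ p → + y p i j ℤ.- + y¹ i j) ≡ + y² i j ℤ.- + y¹ i j
    parts-add-up i j with a j Fin.≟ b j
    ... | yes unmoved = trans (Σℤ-zero (λ p → Δ-stays (y≐σ p) i (stays p))) (sym (Δ-stays y²≐b i (sym unmoved)))
      where
      stays : ∀ p → σ p j ≡ a j
      stays p = [ id , (λ e → ⊥-elim (proj₂ (proj₂ (P⊆D p _ _ _ e)) unmoved)) ]′ (stays-or-carries p j)
    ... | no moved with D⊆P (a j) (b j) j (CDG-moved y¹≐a y²≐b moved)
    ...   | p₀ , carried = trans (Σℤ-single p₀ (λ p p≢p₀ → Δ-stays (y≐σ p) i (stays p p≢p₀)))
                                 (cong (λ s → + s ℤ.- + y¹ i j) y₀ij≡y²ij)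
      where
      stays : ∀ p → p ≢ p₀ → σ p j ≡ a j
      stays p p≢p₀ = [ id , (λ e → ⊥-elim (p≢p₀ (P-disjoint p p₀ _ _ _ e carried))) ]′ (stays-or-carries p j)
      y₀ij≡y²ij : y p₀ i j ≡ y² i j
      σ₀j≡bj : σ p₀ j ≡ b j
      σ₀j≡bj = sym (proj₂ (CDG-ends y¹≐a (y≐σ p₀) (to (P≅ p₀ _ _ _) carried)))
      y₀ij≡y²ij = trans (y≐σ p₀ i j) (trans (cong (δ i) σ₀j≡bj) (sym (y²≐b i j)))

  shareEdge⇒indecomposable : ShareEdge κ⁻ κ⁺ y¹ y² → ¬ NontrivialDecomposition κ⁻ κ⁺ y¹ D
  shareEdge⇒indecomposable (c , c·y¹≡c·y² , c-maximal) (m , P , 2≤m , P⊆D , D⊆P , P-disjoint , P-nonempty , P-valid) =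
    ℤ.<-irrefl total≡0 total<0
    where
    open Parts P P⊆D D⊆P P-disjoint P-valid

    total≡0 : Σℤ (λ p → dot c (y p) ℤ.- dot c y¹) ≡ + 0
    total≡0 = trans (dot-superposition c y y¹ y² parts-add-up)
                    (trans (cong (ℤ._- dot c y¹) (sym c·y¹≡c·y²)) (ℤ.+-inverseʳ (dot c y¹)))

    each<0 : ∀ p → dot c (y p) ℤ.- dot c y¹ ℤ.< + 0
    each<0 p = subst (dot c (y p) ℤ.- dot c y¹ ℤ.<_) (ℤ.+-inverseʳ (dot c y¹))
      (ℤ.+-monoˡ-< (ℤ.- dot c y¹) (c-maximal (y p) (y-vertex p) (part≢y¹ p (P-nonempty p))
        (part≢y² p (proj₁ (another 2≤m p)) (proj₂ (another 2≤m p)) (P-nonempty (proj₁ (another 2≤m p))))))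

    total<0 : Σℤ (λ p → dot c (y p) ℤ.- dot c y¹) ℤ.< + 0
    total<0 = subst (Σℤ (λ p → dot c (y p) ℤ.- dot c y¹) ℤ.<_) (Σℤ-zero {m} (λ _ → refl))
      (Σℤ-mono-< (λ p → ℤ.<⇒≤ (each<0 p)) p₀ (each<0 p₀))
      where p₀ = Fin.fromℕ< {0} (ℕ.≤-trans (s≤s z≤n) 2≤m)

  -- A certificate for edges

  Blocked : ∀ {T : Pred (Fin n) 0ℓ} → Decidable T → Set
  Blocked T? = ∃ λ u → ¬ Free¹ u × ∣a∣ u ≡ ∣b∣ u × size (pt (override T? a b)) u ≢ ∣a∣ u

  IntermediatesBlocked : Set₁
  IntermediatesBlocked = ∀ {T : Pred (Fin n) 0ℓ} (T? : Decidable T) → (∀ j → T j → Moved j) →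
    ∃ T → (∃ λ j → ¬ T j × Moved j) → Blocked T?

  stray : Fin k → Fin n → ℕ
  stray i j = 𝟙 (¬? (i Fin.≟ a j ⊎-dec i Fin.≟ b j))

  φ : Fin k → ℤ
  φ u = bound-weight (∣a∣ u) (∣b∣ u) (κ⁻ u) (κ⁺ u)

  certificate : Fin k → Fin n → ℤ
  certificate i j = φ i ℤ.- + stray i j

  Φ : Pt k n → ℤ
  Φ z = Σℤ (λ u → φ u ℤ.* + size z u)

  Stray : Pt k n → ℕ
  Stray z = Σℕ (λ i → Σℕ (λ j → stray i j * z i j))

  dot-certificate : ∀ z → dot certificate z ≡ Φ z ℤ.- + Stray z
  dot-certificate z = begin
    Σℤ (λ i → Σℤ (λ j → (φ i ℤ.- + stray i j) ℤ.* + z i j))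
      ≡⟨ Σℤ-cong (λ i → Σℤ-cong (λ j → [y-z]x≈yx-zx (+ z i j) (φ i) (+ stray i j))) ⟩
    Σℤ (λ i → Σℤ (λ j → φ i ℤ.* + z i j ℤ.- + stray i j ℤ.* + z i j))
      ≡⟨ Σℤ-cong (λ i → Σℤ-- (λ j → φ i ℤ.* + z i j) (λ j → + stray i j ℤ.* + z i j)) ⟩
    Σℤ (λ i → Σℤ (λ j → φ i ℤ.* + z i j) ℤ.- Σℤ (λ j → + stray i j ℤ.* + z i j))
      ≡⟨ Σℤ-- (λ i → Σℤ (λ j → φ i ℤ.* + z i j)) (λ i → Σℤ (λ j → + stray i j ℤ.* + z i j)) ⟩
    Σℤ (λ i → Σℤ (λ j → φ i ℤ.* + z i j)) ℤ.- Σℤ (λ i → Σℤ (λ j → + stray i j ℤ.* + z i j))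
      ≡⟨ cong₂ ℤ._-_ (Σℤ-cong (λ i → trans (Σℤ-*ˡ (φ i) (λ j → + z i j)) (cong (φ i ℤ.*_) (Σℤ-pos (z i)))))
                     (trans (Σℤ-cong (λ i → trans (Σℤ-cong (λ j → sym (ℤ.pos-* (stray i j) (z i j))))
                                                  (Σℤ-pos (λ j → stray i j * z i j))))
                            (Σℤ-pos (λ i → Σℕ (λ j → stray i j * z i j)))) ⟩
    Φ z ℤ.- + Stray z
      ∎
    where open ≡-Reasoning

  Allowed : (Fin n → Fin k) → Set
  Allowed σ = ∀ j → σ j ≡ a j ⊎ σ j ≡ b j

  Stray-allowed : ∀ {z : Pt k n} {σ} → z ≐ pt σ → Allowed σ → Stray z ≡ 0
  Stray-allowed {z} {σ} z≐σ allowed = Σℕ-zero (λ i → Σℕ-zero (λ j → trans (cong (stray i j *_) (z≐σ i j)) (no-stray i j)))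
    where
    no-stray : ∀ i j → stray i j * δ i (σ j) ≡ 0
    no-stray i j with i Fin.≟ σ j
    ... | yes refl = cong (_* 1) (𝟙-no (¬? (σ j Fin.≟ a j ⊎-dec σ j Fin.≟ b j)) (λ ¬allowed → ¬allowed (allowed j)))
    ... | no _     = ℕ.*-zeroʳ (stray i j)

  Stray-positive : ∀ {z : Pt k n} {σ} → z ≐ pt σ → ∀ j → ¬ (σ j ≡ a j ⊎ σ j ≡ b j) → 1 ≤ Stray z
  Stray-positive {z} {σ} z≐σ j not-allowed = begin
    1                                    ≡⟨ cong₂ _*_ (𝟙-yes (¬? (σ j Fin.≟ a j ⊎-dec σ j Fin.≟ b j)) not-allowed)
                                                      (trans (z≐σ (σ j) j) (δ-refl (σ j))) ⟨
    stray (σ j) j * z (σ j) j            ≤⟨ Σℕ-≥-term (λ j′ → stray (σ j) j′ * z (σ j) j′) j ⟩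
    Σℕ (λ j′ → stray (σ j) j′ * z (σ j) j′) ≤⟨ Σℕ-≥-term (λ i → Σℕ (λ j′ → stray i j′ * z i j′)) (σ j) ⟩
    Stray z                              ∎
    where open ℕ.≤-Reasoning

  dot-certificate-allowed : ∀ {z : Pt k n} {σ} → z ≐ pt σ → Allowed σ → dot certificate z ≡ Φ z
  dot-certificate-allowed {z} z≐σ allowed =
    trans (dot-certificate z) (trans (cong (λ s → Φ z ℤ.- + s) (Stray-allowed z≐σ allowed)) (ℤ.+-identityʳ (Φ z)))

  Φ-y¹≡Φ-y² : Φ y¹ ≡ Φ y²
  Φ-y¹≡Φ-y² = Σℤ-cong λ u → begin
    φ u ℤ.* + size y¹ u        ≡⟨ cong (λ s → φ u ℤ.* + s) (size¹ u) ⟩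
    φ u ℤ.* + ∣a∣ u    ≡⟨ bound-weight-balanced (∣a∣ u) (∣b∣ u) (κ⁻ u) (κ⁺ u) ⟩
    φ u ℤ.* + ∣b∣ u    ≡⟨ cong (λ s → φ u ℤ.* + s) (size² u) ⟨
    φ u ℤ.* + size y² u        ∎
    where open ≡-Reasoning

  φ-max : ∀ {z : Pt k n} → IsVertex κ⁻ κ⁺ z → ∀ u → φ u ℤ.* + size z u ℤ.≤ φ u ℤ.* + size y¹ u
  φ-max (_ , _ , bounds) u =
    subst (λ s → φ u ℤ.* + _ ℤ.≤ φ u ℤ.* + s) (sym (size¹ u))
      (bound-weight-max (∣a∣ u) (∣b∣ u) (proj₁ (bounds u)) (proj₂ (bounds u)))

  Φ-max : ∀ {z : Pt k n} → IsVertex κ⁻ κ⁺ z → Φ z ℤ.≤ Φ y¹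
  Φ-max Vz = Σℤ-mono-≤ (φ-max Vz)

  Φ-strict : ∀ {z : Pt k n} → IsVertex κ⁻ κ⁺ z → ∀ u → ¬ Free¹ u → ∣a∣ u ≡ ∣b∣ u →
    size z u ≢ ∣a∣ u → Φ z ℤ.< Φ y¹
  Φ-strict {z} Vz@(_ , _ , bounds) u not-free balanced resized = Σℤ-mono-< (φ-max Vz) u
    (subst (λ s → φ u ℤ.* + size z u ℤ.< φ u ℤ.* + s) (sym (size¹ u))
      (bound-weight-strict (∣a∣ u) (∣b∣ u) balanced
        (at-bound (proj₁ (a-feasible u)) (proj₂ (a-feasible u)) not-free-a) resized (proj₁ (bounds u)) (proj₂ (bounds u))))
    where
    not-free-a : ¬ (κ⁻ u < ∣a∣ u × ∣a∣ u < κ⁺ u)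
    not-free-a = not-free ∘ subst (λ s → κ⁻ u < s × s < κ⁺ u) (sym (size¹ u))

  stray-loses : ∀ {z σ} → IsVertex κ⁻ κ⁺ z → z ≐ pt σ → ∀ j → ¬ (σ j ≡ a j ⊎ σ j ≡ b j) → dot certificate z ℤ.< Φ y¹
  stray-loses {z} Vz z≐σ j stray-j = begin-strict
    dot certificate z   ≡⟨ dot-certificate z ⟩
    Φ z ℤ.- + Stray z   ≤⟨ ℤ.+-monoʳ-≤ (Φ z) (ℤ.neg-mono-≤ (ℤ.+≤+ (Stray-positive z≐σ j stray-j))) ⟩
    Φ z ℤ.- + 1         <⟨ ℤ.i≤pred[j]⇒i<j (ℤ.≤-reflexive (ℤ.+-comm (Φ z) ℤ.-1ℤ)) ⟩
    Φ z                 ≤⟨ Φ-max Vz ⟩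
    Φ y¹                ∎
    where open ℤ.≤-Reasoning

  intermediate-loses : IntermediatesBlocked → ∀ {z σ} → IsVertex κ⁻ κ⁺ z → z ≐ pt σ → Allowed σ →
    ¬ (z ≐ y¹) → ¬ (z ≐ y²) → dot certificate z ℤ.< Φ y¹
  intermediate-loses blocked {z} {σ} Vz z≐σ allowed z≢y¹ z≢y² with blocked T? T⊆Moved some-T some-¬T
    where
    T : Pred (Fin n) 0ℓ
    T j = σ j ≢ a j
    T? : Decidable T
    T? j = ¬? (σ j Fin.≟ a j)
    T⊆Moved : ∀ j → T j → Moved j
    T⊆Moved j σj≢aj aj≡bj = [ σj≢aj , (λ σj≡bj → σj≢aj (trans σj≡bj (sym aj≡bj))) ]′ (allowed j)
    some-T : ∃ T
    some-T = Fin.¬∀⟶∃¬ n _ (λ j → σ j Fin.≟ a j)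
               (λ σ≗a → z≢y¹ (λ i j → trans (z≐σ i j) (trans (cong (δ i) (σ≗a j)) (sym (y¹≐a i j)))))
    some-¬T : ∃ λ j → ¬ T j × Moved j
    some-¬T with Fin.¬∀⟶∃¬ n _ (λ j → σ j Fin.≟ b j)
                   (λ σ≗b → z≢y² (λ i j → trans (z≐σ i j) (trans (cong (δ i) (σ≗b j)) (sym (y²≐b i j)))))
    ... | j , σj≢bj with allowed j
    ...   | inj₁ σj≡aj = j , (λ σj≢aj → σj≢aj σj≡aj) , (λ aj≡bj → σj≢bj (trans σj≡aj aj≡bj))
    ...   | inj₂ σj≡bj = ⊥-elim (σj≢bj σj≡bj)
  ... | u , not-free , balanced , resized = begin-strict
    dot certificate z   ≡⟨ dot-certificate-allowed z≐σ allowed ⟩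
    Φ z                 <⟨ Φ-strict Vz u not-free balanced (resized ∘ trans (trans override-size (sym (size-≐ z≐σ u)))) ⟩
    Φ y¹                ∎
    where
    open ℤ.≤-Reasoning
    override-size : size (pt (override (λ j → ¬? (σ j Fin.≟ a j)) a b)) u ≡ size (pt σ) u
    override-size = Σℕ-cong λ j → cong (δ u) (override-≡ (λ j → ¬? (σ j Fin.≟ a j)) {a} {b} j
      (λ σj≢aj → [ (λ σj≡aj → ⊥-elim (σj≢aj σj≡aj)) , sym ]′ (allowed j))
      (sym ∘ decidable-stable (σ j Fin.≟ a j)))

  blocked⇒shareEdge : IntermediatesBlocked → ShareEdge κ⁻ κ⁺ y¹ y²
  blocked⇒shareEdge blocked = certificate , trans dot-certificate-y¹ (trans Φ-y¹≡Φ-y² (sym dot-certificate-y²)) , maximal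
    where
    dot-certificate-y¹ : dot certificate y¹ ≡ Φ y¹
    dot-certificate-y¹ = dot-certificate-allowed y¹≐a (λ _ → inj₁ refl)
    dot-certificate-y² : dot certificate y² ≡ Φ y²
    dot-certificate-y² = dot-certificate-allowed y²≐b (λ _ → inj₂ refl)
    maximal : ∀ z → IsVertex κ⁻ κ⁺ z → ¬ (z ≐ y¹) → ¬ (z ≐ y²) → dot certificate z ℤ.< dot certificate y¹
    maximal z Vz z≢y¹ z≢y² = subst (dot certificate z ℤ.<_) (sym dot-certificate-y¹) (by-strays (Fin.all? allowed?))
      where
      σ = proj₁ (assignment Vz)
      z≐σ = proj₂ (assignment Vz)
      allowed? : ∀ j → Dec (σ j ≡ a j ⊎ σ j ≡ b j)
      allowed? j = σ j Fin.≟ a j ⊎-dec σ j Fin.≟ b j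
      by-strays : Dec (Allowed σ) → dot certificate z ℤ.< Φ y¹
      by-strays (yes allowed)    = intermediate-loses blocked Vz z≐σ allowed z≢y¹ z≢y²
      by-strays (no not-allowed) = uncurry (stray-loses Vz z≐σ) (Fin.¬∀⟶∃¬ n _ allowed? not-allowed)

  -- Trails

  Leaving Entering : Fin k → Fin n → Set
  Leaving u j = Moved j × a j ≡ u
  Entering u j = Moved j × b j ≡ u

  Sole : (Fin n → Set) → Fin n → Set
  Sole P j₀ = P j₀ × (∀ j → P j → j ≡ j₀)

  module _ {u jₒ jᵢ} (only-out : Sole (Leaving u) jₒ) (only-in : Sole (Entering u) jᵢ) where

    out-hits : ∀ {T : Pred (Fin n) 0ℓ} (T? : Decidable T) → (∀ j → T j → Moved j) → hits T? a u ≡ 𝟙 (T? jₒ)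
    out-hits T? T⊆Moved =
      hits-single T? jₒ (proj₂ (proj₁ only-out)) (λ j j∈T aj≡u → proj₂ only-out j (T⊆Moved j j∈T , aj≡u))

    in-hits : ∀ {T : Pred (Fin n) 0ℓ} (T? : Decidable T) → (∀ j → T j → Moved j) → hits T? b u ≡ 𝟙 (T? jᵢ)
    in-hits T? T⊆Moved =
      hits-single T? jᵢ (proj₂ (proj₁ only-in)) (λ j j∈T bj≡u → proj₂ only-in j (T⊆Moved j j∈T , bj≡u))

    transit-size : ∀ {T : Pred (Fin n) 0ℓ} (T? : Decidable T) → (∀ j → T j → Moved j) →
      size (pt (override T? a b)) u + 𝟙 (T? jₒ) ≡ ∣a∣ u + 𝟙 (T? jᵢ)
    transit-size T? T⊆Moved = begin
      size (pt (override T? a b)) u + 𝟙 (T? jₒ)   ≡⟨ cong (_+_ (size (pt (override T? a b)) u)) (out-hits T? T⊆Moved) ⟨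
      size (pt (override T? a b)) u + hits T? a u ≡⟨ size-override T? a b u ⟩
      ∣a∣ u + hits T? b u                         ≡⟨ cong (_+_ (∣a∣ u)) (in-hits T? T⊆Moved) ⟩
      ∣a∣ u + 𝟙 (T? jᵢ)                           ∎
      where open ≡-Reasoning

    transit-balanced : ∣a∣ u ≡ ∣b∣ u
    transit-balanced = sym (ℕ.+-cancelʳ-≡ 1 _ _ (begin
      ∣b∣ u + 1                 ≡⟨ cong (_+_ (∣b∣ u)) (trans (out-hits Moved? (λ _ → id)) (𝟙-yes (Moved? jₒ) out-moved)) ⟨
      ∣b∣ u + hits Moved? a u   ≡⟨ flow u ⟩
      ∣a∣ u + hits Moved? b u   ≡⟨ cong (_+_ (∣a∣ u)) (trans (in-hits Moved? (λ _ → id)) (𝟙-yes (Moved? jᵢ) in-moved)) ⟩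
      ∣a∣ u + 1                 ∎))
      where
      open ≡-Reasoning
      out-moved = proj₁ (proj₁ only-out)
      in-moved = proj₁ (proj₁ only-in)

    transit-blocks : ¬ Free¹ u → ∀ {T : Pred (Fin n) 0ℓ} (T? : Decidable T) → (∀ j → T j → Moved j) →
      𝟙 (T? jᵢ) ≢ 𝟙 (T? jₒ) → Blocked T?
    transit-blocks not-free T? T⊆Moved differ = u , not-free , transit-balanced ,
      λ resized → differ (sym (ℕ.+-cancelˡ-≡ _ _ _
        (trans (cong (_+ 𝟙 (T? jₒ)) (sym resized)) (transit-size T? T⊆Moved))))

  record Walk : Set where
    field
      r      : ℕ
      v      : ℕ → Fin k
      lab    : ℕ → Fin n
      leaves : ∀ {t} → t < r → a (lab t) ≡ v t
      enters : ∀ {t} → t < r → b (lab t) ≡ v (suc t)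

    Covers : Set
    Covers = ∀ j → Moved j → ∃ λ t → t < r × lab t ≡ j

    Uncovered : Set
    Uncovered = ∃ λ j → Moved j × ¬ (∃ λ t → t < r × lab t ≡ j)

  record Trail : Set where
    field
      walk : Walk
    open Walk walk public
    field
      steps          : ∀ {t} → t < r → v t ≢ v (suc t)
      tails-distinct : ∀ {s t} → s < r → t < r → v s ≡ v t → s ≡ t
      heads-distinct : ∀ {s t} → s < r → t < r → v (suc s) ≡ v (suc t) → s ≡ t

    moved : ∀ {t} → t < r → Moved (lab t)
    moved t<r aj≡bj = steps t<r (trans (sym (leaves t<r)) (trans aj≡bj (enters t<r)))

    transit : Covers → ∀ {tₒ tᵢ} → tₒ < r → tᵢ < r → v tₒ ≡ v (suc tᵢ) →
      Sole (Leaving (v tₒ)) (lab tₒ) × Sole (Entering (v tₒ)) (lab tᵢ)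
    transit covers {tₒ} {tᵢ} tₒ<r tᵢ<r joins =
      ((moved tₒ<r , leaves tₒ<r) , only-out) , ((moved tᵢ<r , trans (enters tᵢ<r) (sym joins)) , only-in)
      where
      only-out : ∀ j → Leaving (v tₒ) j → j ≡ lab tₒ
      only-out j (moved-j , aj≡u) with covers j moved-j
      ... | t , t<r , refl = cong lab (tails-distinct t<r tₒ<r (trans (sym (leaves t<r)) aj≡u))
      only-in : ∀ j → Entering (v tₒ) j → j ≡ lab tᵢ
      only-in j (moved-j , bj≡u) with covers j moved-j
      ... | t , t<r , refl = cong lab (heads-distinct t<r tᵢ<r (trans (sym (enters t<r)) (trans bj≡u joins)))

    balanced : Covers → ∀ {tₒ tᵢ} → tₒ < r → tᵢ < r → v tₒ ≡ v (suc tᵢ) → ∣a∣ (v tₒ) ≡ ∣b∣ (v tₒ)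
    balanced covers tₒ<r tᵢ<r joins = transit-balanced (proj₁ node) (proj₂ node)
      where node = transit covers tₒ<r tᵢ<r joins

    edge : ∀ {t} → t < r → D (v t) (v (suc t)) (lab t)
    edge {t} t<r = subst₂ (λ x y → D x y (lab t)) (leaves t<r) (enters t<r) (CDG-moved y¹≐a y²≐b (moved t<r))

    walk-edges : Covers → WalkEdges D (v ∘ toℕ) (lab ∘ toℕ)
    walk-edges covers i ℓ j = mk⇔ forward backward
      where
      forward : D i ℓ j → ∃ λ e → i ≡ v (toℕ (inject₁ e)) × ℓ ≡ v (suc (toℕ e)) × j ≡ lab (toℕ e)
      forward edge@(_ , _ , i≢ℓ) with CDG-ends y¹≐a y²≐b edge
      ... | i≡aj , ℓ≡bj with covers j (λ aj≡bj → i≢ℓ (trans i≡aj (trans aj≡bj (sym ℓ≡bj))))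
      ...   | t , t<r , refl =
        fromℕ< t<r ,
        trans i≡aj (trans (leaves t<r) (cong v (sym (trans (Fin.toℕ-inject₁ (fromℕ< t<r)) (Fin.toℕ-fromℕ< t<r))))) ,
        trans ℓ≡bj (trans (enters t<r) (cong (v ∘ suc) (sym (Fin.toℕ-fromℕ< t<r)))) ,
        cong lab (sym (Fin.toℕ-fromℕ< t<r))
      backward : (∃ λ e → i ≡ v (toℕ (inject₁ e)) × ℓ ≡ v (suc (toℕ e)) × j ≡ lab (toℕ e)) → D i ℓ j
      backward (e , i≡ , ℓ≡ , j≡) =
        subst₂ (λ x z → D x ℓ z) (sym (trans i≡ (cong v (Fin.toℕ-inject₁ e)))) (sym j≡)
          (subst (λ y → D (v (toℕ e)) y (lab (toℕ e))) (sym ℓ≡) (edge (Fin.toℕ<n e)))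

    profile : ∀ {T : Pred (Fin n) 0ℓ} → Decidable T → ℕ → ℕ
    profile T? t = 𝟙 (T? (lab t))

    profile-varies : Covers → ∀ {T : Pred (Fin n) 0ℓ} (T? : Decidable T) → (∀ j → T j → Moved j) →
      ∃ T → (∃ λ j → ¬ T j × Moved j) → ∃ λ t₀ → ∃ λ t₁ → t₀ < r × t₁ < r × profile T? t₀ ≢ profile T? t₁
    profile-varies covers T? T⊆Moved (j₀ , j₀∈T) (j₁ , j₁∉T , moved-j₁)
      with covers j₀ (T⊆Moved j₀ j₀∈T) | covers j₁ moved-j₁
    ... | t₀ , t₀<r , refl | t₁ , t₁<r , refl =
      t₀ , t₁ , t₀<r , t₁<r ,
      λ p₀≡p₁ → ℕ.1+n≢0 (trans (sym (𝟙-yes (T? (lab t₀)) j₀∈T)) (trans p₀≡p₁ (𝟙-no (T? (lab t₁)) j₁∉T)))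

    path-blocked : Covers → (∀ {s} → 0 < s → s < r → ¬ Free¹ (v s)) → IntermediatesBlocked
    path-blocked covers interior-fixed T? T⊆Moved some-T some-¬T
      with profile-varies covers T? T⊆Moved some-T some-¬T
    ... | t₀ , t₁ , t₀<r , t₁<r , differ with inner-change (profile T?) t₀<r t₁<r differ
    ...   | s , 1+s<r , jump = transit-blocks only-out only-in (interior-fixed (s≤s z≤n) 1+s<r) T? T⊆Moved jump
      where
      node = transit covers 1+s<r (ℕ.<-trans (ℕ.n<1+n s) 1+s<r) refl
      only-out = proj₁ node
      only-in = proj₂ node

    free-position : (∀ {s t} → s < r → t < r → Free¹ (v s) → Free¹ (v t) → s ≡ t) →
      0 < r → ∃ λ e → e < r × (∀ {m} → m < r → m ≢ e → ¬ Free¹ (v m))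
    free-position at-most-one-free 0<r with ℕ.anyUpTo? (λ t → Free¹? (v t)) r
    ... | yes (e , e<r , free-e) = e , e<r , λ m<r m≢e free-m → m≢e (at-most-one-free m<r e<r free-m free-e)
    ... | no none                = 0 , 0<r , λ m<r _ free-m → none (_ , m<r , free-m)

    cycle-blocked : Covers → v r ≡ v 0 → (∀ {s t} → s < r → t < r → Free¹ (v s) → Free¹ (v t) → s ≡ t) →
      IntermediatesBlocked
    cycle-blocked covers closed at-most-one-free T? T⊆Moved some-T some-¬T
      with profile-varies covers T? T⊆Moved some-T some-¬T
    ... | t₀ , t₁ , t₀<r , t₁<r , differ with free-position at-most-one-free (ℕ.≤-<-trans z≤n t₀<r)
    ...   | e , e<r , fixed-elsewhere with cyclic-change (profile T?) e<r t₀<r t₁<r differ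
    ...     | inj₁ (s , 1+s<r , 1+s≢e , jump) =
      transit-blocks (proj₁ node) (proj₂ node) (fixed-elsewhere 1+s<r 1+s≢e) T? T⊆Moved jump
      where node = transit covers 1+s<r (ℕ.<-trans (ℕ.n<1+n s) 1+s<r) refl
    ...     | inj₂ (0≢e , jump) =
      transit-blocks (proj₁ node) (proj₂ node) (fixed-elsewhere 0<r 0≢e) T? T⊆Moved jump
      where
      0<r = ℕ.≤-<-trans z≤n t₀<r
      node = transit covers 0<r (pred<self 0<r) (trans (sym closed) (cong v (sym (suc-pred 0<r))))

  path-trail : (W : Walk) → (let open Walk W in ∀ {s t} → s ≤ r → t ≤ r → v s ≡ v t → s ≡ t) → Trail
  path-trail W injective = record
    { walk           = W
    ; steps          = λ {t} t<r vt≡v1+t → ℕ.<-irrefl (injective (ℕ.<⇒≤ t<r) t<r vt≡v1+t) (ℕ.n<1+n t)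
    ; tails-distinct = λ s<r t<r → injective (ℕ.<⇒≤ s<r) (ℕ.<⇒≤ t<r)
    ; heads-distinct = λ s<r t<r → ℕ.suc-injective ∘ injective s<r t<r
    }
    where open Walk W

  cycle-trail : (W : Walk) → (let open Walk W in
    2 ≤ r → v r ≡ v 0 → (∀ {s t} → s < r → t < r → v s ≡ v t → s ≡ t) → Trail)
  cycle-trail W 2≤r closed injective = record
    { walk           = W
    ; steps          = steps
    ; tails-distinct = injective
    ; heads-distinct = heads-distinct
    }
    where
    open Walk W
    0<r : 0 < r
    0<r = ℕ.≤-trans (s≤s z≤n) 2≤r

    successor : ∀ {s} → s < r → ∃ λ w → w < r × v (suc s) ≡ v w × (suc s ≡ w ⊎ suc s ≡ r × w ≡ 0)
    successor {s} s<r with suc s ℕ.<? r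
    ... | yes 1+s<r = suc s , 1+s<r , refl , inj₁ refl
    ... | no 1+s≮r  = 0 , 0<r , trans (cong v 1+s≡r) closed , inj₂ (1+s≡r , refl)
      where 1+s≡r = ℕ.≤-antisym s<r (ℕ.≮⇒≥ 1+s≮r)

    heads-distinct : ∀ {s t} → s < r → t < r → v (suc s) ≡ v (suc t) → s ≡ t
    heads-distinct s<r t<r eq with successor s<r | successor t<r
    ... | w , w<r , vs≡vw , ws | w′ , w′<r , vt≡vw′ , wt
      with injective w<r w′<r (trans (sym vs≡vw) (trans eq vt≡vw′))
    ...   | refl = ℕ.suc-injective (same ws wt)
      where
      same : ∀ {s t} → suc s ≡ w ⊎ suc s ≡ r × w ≡ 0 → suc t ≡ w ⊎ suc t ≡ r × w ≡ 0 → suc s ≡ suc t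
      same (inj₁ e)       (inj₁ e′)       = trans e (sym e′)
      same (inj₂ (e , _)) (inj₂ (e′ , _)) = trans e (sym e′)
      same (inj₁ e)       (inj₂ (_ , w≡0)) = ⊥-elim (ℕ.1+n≢0 (trans e w≡0))
      same (inj₂ (_ , w≡0)) (inj₁ e′)      = ⊥-elim (ℕ.1+n≢0 (trans e′ w≡0))

    steps : ∀ {t} → t < r → v t ≢ v (suc t)
    steps {t} t<r vt≡v1+t with successor t<r
    ... | w , w<r , v1+t≡vw , wt with injective t<r w<r (trans vt≡v1+t v1+t≡vw)
    ...   | refl with wt
    ...     | inj₁ 1+t≡t         = ℕ.<-irrefl (sym 1+t≡t) (ℕ.n<1+n t)
    ...     | inj₂ (1≡r , refl)  = ℕ.<-irrefl 1≡r 2≤r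

  fin-walk : ∀ {l} (v : Fin (suc (suc l)) → Fin k) (lab : Fin (suc l) → Fin n) → WalkEdges D v lab → Walk
  fin-walk {l} v lab edges = record
    { r      = suc l
    ; v      = v ∘ clamp (suc l)
    ; lab    = lab ∘ clamp l
    ; leaves = λ {t} t<r → trans (proj₁ (edge-ends (clamp l t))) (cong v (inject₁-clamp (ℕ.≤-pred t<r)))
    ; enters = λ {t} _ → proj₂ (edge-ends (clamp l t))
    }
    where
    edge-ends : ∀ e → a (lab e) ≡ v (inject₁ e) × b (lab e) ≡ v (suc e)
    edge-ends e with CDG-ends y¹≐a y²≐b (from (edges _ _ _) (e , refl , refl , refl))
    ... | from-a , to-b = sym from-a , sym to-b

  fin-walk-covers : ∀ {l} (v : Fin (suc (suc l)) → Fin k) (lab : Fin (suc l) → Fin n) (edges : WalkEdges D v lab) →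
    Walk.Covers (fin-walk v lab edges)
  fin-walk-covers v lab edges j moved-j with to (edges _ _ _) (CDG-moved y¹≐a y²≐b moved-j)
  ... | e , _ , _ , j≡lab-e = toℕ e , Fin.toℕ<n e , trans (cong lab (clamp-toℕ e)) (sym j≡lab-e)

  path⇒blocked : PathNoFreeInterior κ⁻ κ⁺ y¹ D → IntermediatesBlocked
  path⇒blocked (suc l , v , lab , _ , injective , edges , interior-fixed) =
    Trail.path-blocked trail (fin-walk-covers v lab edges) fixed
    where
    trail = path-trail (fin-walk v lab edges) (λ s≤r t≤r eq → clamp-injective s≤r t≤r (injective _ _ eq))
    fixed : ∀ {s} → 0 < s → s < suc l → ¬ Free¹ (v (clamp (suc l) s))
    fixed {s} 0<s s<r = interior-fixed (clamp (suc l) s) (subst (0 <_) (sym (toℕ-clamp (ℕ.<⇒≤ s<r))) 0<s)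
                                                         (subst (_< suc l) (sym (toℕ-clamp (ℕ.<⇒≤ s<r))) s<r)

  cycle⇒blocked : CycleAtMostOneFree κ⁻ κ⁺ y¹ D → IntermediatesBlocked
  cycle⇒blocked (suc l , v , lab , 2≤r , closed , injective , edges , at-most-one-free) =
    Trail.cycle-blocked trail (fin-walk-covers v lab edges) closed′ one-free
    where
    at : ∀ {t} → t < suc l → v (clamp (suc l) t) ≡ v (inject₁ (clamp l t))
    at t<r = cong v (sym (inject₁-clamp (ℕ.≤-pred t<r)))
    closed′ : v (clamp (suc l) (suc l)) ≡ v (clamp (suc l) 0)
    closed′ = trans (cong v (clamp-self (suc l))) closed
    injective′ : ∀ {s t} → s < suc l → t < suc l → v (clamp (suc l) s) ≡ v (clamp (suc l) t) → s ≡ t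
    injective′ s<r t<r eq = clamp-injective (ℕ.≤-pred s<r) (ℕ.≤-pred t<r)
      (injective _ _ (trans (sym (at s<r)) (trans eq (at t<r))))
    trail = cycle-trail (fin-walk v lab edges) 2≤r closed′ injective′
    one-free : ∀ {s t} → s < suc l → t < suc l → Free¹ (v (clamp (suc l) s)) → Free¹ (v (clamp (suc l) t)) → s ≡ t
    one-free s<r t<r free-s free-t = clamp-injective (ℕ.≤-pred s<r) (ℕ.≤-pred t<r)
      (at-most-one-free _ _ (subst (Free¹) (at s<r) free-s) (subst (Free¹) (at t<r) free-t))

  Structure : Set
  Structure = SingleEdge D ⊎ PathNoFreeInterior κ⁻ κ⁺ y¹ D ⊎ CycleAtMostOneFree κ⁻ κ⁺ y¹ D

  structure⇒shareEdge : Structure → ShareEdge κ⁻ κ⁺ y¹ y²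
  structure⇒shareEdge (inj₁ single)       =
    blocked⇒shareEdge (path⇒blocked (single-edge-path {κ⁻ = κ⁻} {κ⁺} {y¹} (proj₂ ∘ proj₂) single))
  structure⇒shareEdge (inj₂ (inj₁ path))  = blocked⇒shareEdge (path⇒blocked path)
  structure⇒shareEdge (inj₂ (inj₂ cycle)) = blocked⇒shareEdge (cycle⇒blocked cycle)

  -- Decomposing along trails

  CDG-override : ∀ {T : Pred (Fin n) 0ℓ} (T? : Decidable T) {i ℓ j} →
    CDG y¹ (pt (override T? a b)) i ℓ j ⇔ (D i ℓ j × T j)
  CDG-override {T} T? {i} {ℓ} {j} = mk⇔ forward backward
    where
    forward : CDG y¹ (pt (override T? a b)) i ℓ j → D i ℓ j × T j
    forward edge@(y¹ij≡1 , _ , i≢ℓ) = by-side (T? j)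
      where
      ends = CDG-ends {τ = override T? a b} y¹≐a (λ _ _ → refl) edge
      i≡aj = proj₁ ends
      ℓ≡σj = proj₂ ends
      by-side : Dec (T j) → D i ℓ j × T j
      by-side (yes j∈T) =
        (y¹ij≡1 , trans (y²≐b ℓ j) (δ-≡ (trans ℓ≡σj (override-∈ T? {a} {b} j j∈T))) , i≢ℓ) , j∈T
      by-side (no j∉T)  = ⊥-elim (i≢ℓ (trans i≡aj (sym (trans ℓ≡σj (override-∉ T? {a} {b} j j∉T)))))
    backward : D i ℓ j × T j → CDG y¹ (pt (override T? a b)) i ℓ j
    backward (edge@(y¹ij≡1 , _ , i≢ℓ) , j∈T) with CDG-ends y¹≐a y²≐b edge
    ... | _ , ℓ≡bj = y¹ij≡1 , δ-≡ (trans ℓ≡bj (sym (override-∈ T? {a} {b} j j∈T))) , i≢ℓ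

  split-decomposition : ∀ {T : Pred (Fin n) 0ℓ} (T? : Decidable T) →
    Feasible κ⁻ κ⁺ (override T? a b) → Feasible κ⁻ κ⁺ (override T? b a) →
    (∃ λ j → T j × Moved j) → (∃ λ j → ¬ T j × Moved j) → NontrivialDecomposition κ⁻ κ⁺ y¹ D
  split-decomposition {T} T? feasible feasible′ (j₀ , j₀∈T , moved-j₀) (j₁ , j₁∉T , moved-j₁) =
    2 , P , s≤s (s≤s z≤n) , P⊆D , D⊆P , disjoint , nonempty , valid
    where
    ¬T? : Decidable (λ j → ¬ T j)
    ¬T? j = ¬? (T? j)
    side : Fin 2 → Fin n → Fin k
    side zero    = override T? a b
    side (suc _) = override ¬T? a b
    P : Fin 2 → LGraph k n
    P p = CDG y¹ (pt (side p))
    P⊆D : ∀ p i ℓ j → P p i ℓ j → D i ℓ j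
    P⊆D zero       i ℓ j e = proj₁ (to (CDG-override T? ) e)
    P⊆D (suc zero) i ℓ j e = proj₁ (to (CDG-override ¬T?) e)
    D⊆P : ∀ i ℓ j → D i ℓ j → ∃ λ p → P p i ℓ j
    D⊆P i ℓ j e with T? j
    ... | yes j∈T = zero , from (CDG-override T?) (e , j∈T)
    ... | no j∉T  = suc zero , from (CDG-override ¬T?) (e , j∉T)
    disjoint : ∀ p q i ℓ j → P p i ℓ j → P q i ℓ j → p ≡ q
    disjoint zero       zero       _ _ _ _ _ = refl
    disjoint (suc zero) (suc zero) _ _ _ _ _ = refl
    disjoint zero       (suc zero) _ _ _ e e′ = ⊥-elim (proj₂ (to (CDG-override ¬T?) e′) (proj₂ (to (CDG-override T?) e)))
    disjoint (suc zero) zero       _ _ _ e e′ = ⊥-elim (proj₂ (to (CDG-override ¬T?) e) (proj₂ (to (CDG-override T?) e′)))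
    nonempty : ∀ p → NonEmpty (P p)
    nonempty zero       = a j₀ , b j₀ , j₀ , from (CDG-override T?) (CDG-moved y¹≐a y²≐b moved-j₀ , j₀∈T)
    nonempty (suc zero) = a j₁ , b j₁ , j₁ , from (CDG-override ¬T?) (CDG-moved y¹≐a y²≐b moved-j₁ , j₁∉T)
    side≗ : ∀ j → override T? b a j ≡ override ¬T? a b j
    side≗ j = override-≡ T? {b} {a} j (λ j∈T → sym (override-∉ ¬T? {a} {b} j (λ j∉T → j∉T j∈T)))
                                      (λ j∉T → sym (override-∈ ¬T? {a} {b} j j∉T))
    valid : ∀ p → ValidCDG κ⁻ κ⁺ y¹ (P p)
    valid zero       = pt (side zero) , feasible-vertex feasible , λ _ _ _ → mk⇔ id id
    valid (suc zero) = pt (side (suc zero)) , feasible-vertex feasible¬T , λ _ _ _ → mk⇔ id id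
      where
      feasible¬T : Feasible κ⁻ κ⁺ (override ¬T? a b)
      feasible¬T u = subst (λ s → κ⁻ u ≤ s × s ≤ κ⁺ u) (Σℕ-cong (λ j → cong (δ u) (side≗ j))) (feasible′ u)

  Releasing Absorbing : Fin k → Set
  Releasing u = κ⁻ u < ∣a∣ u × ∣b∣ u < κ⁺ u
  Absorbing u = ∣a∣ u < κ⁺ u × κ⁻ u < ∣b∣ u

  Slack : Trail → Set
  Slack W = v 0 ≢ v r → Releasing (v 0) × Absorbing (v r)
    where open Trail W

  module Cut (W : Trail) (0<r : 0 < Trail.r W) (slack : Slack W) where
    open Trail W

    T : Pred (Fin n) 0ℓ
    T j = ∃ λ t → t < r × lab t ≡ j

    T? : Decidable T
    T? j = ℕ.anyUpTo? (λ t → lab t Fin.≟ j) r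

    Visits : (ℕ → Fin k) → Fin k → Set
    Visits w u = ∃ λ t → t < r × w t ≡ u

    visits? : ∀ w u → Dec (Visits w u)
    visits? w u = ℕ.anyUpTo? (λ t → w t Fin.≟ u) r

    label-hits : ∀ (g : Fin n → Fin k) (w : ℕ → Fin k) → (∀ {t} → t < r → g (lab t) ≡ w t) →
      (∀ {s t} → s < r → t < r → w s ≡ w t → s ≡ t) → ∀ u → hits T? g u ≡ 𝟙 (visits? w u)
    label-hits g w g≡w w-distinct u with visits? w u
    ... | yes (t , t<r , wt≡u) =
      trans (hits-single T? (lab t) (trans (g≡w t<r) wt≡u) unique) (𝟙-yes (T? (lab t)) (t , t<r , refl))
      where
      unique : ∀ j → T j → g j ≡ u → j ≡ lab t
      unique j (t′ , t′<r , refl) gj≡u = cong lab (w-distinct t′<r t<r (trans (sym (g≡w t′<r)) (trans gj≡u (sym wt≡u))))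
    ... | no unvisited = hits-none T? (λ { j (t , t<r , refl) gj≡u → unvisited (t , t<r , trans (sym (g≡w t<r)) gj≡u) })

    tail-hits : ∀ u → hits T? a u ≡ 𝟙 (visits? v u)
    tail-hits = label-hits a v leaves tails-distinct

    head-hits : ∀ u → hits T? b u ≡ 𝟙 (visits? (v ∘ suc) u)
    head-hits = label-hits b (v ∘ suc) enters heads-distinct

    tail-only : ∀ {u} → Visits v u → ¬ Visits (v ∘ suc) u → u ≡ v 0 × v 0 ≢ v r
    tail-only (zero , _ , v0≡u) no-head =
      sym v0≡u , λ v0≡vr → no-head (pred r , pred<self 0<r , trans (cong v (suc-pred 0<r)) (trans (sym v0≡vr) v0≡u))
    tail-only (suc t , 1+t<r , v1+t≡u) no-head = ⊥-elim (no-head (t , ℕ.<-trans (ℕ.n<1+n t) 1+t<r , v1+t≡u))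

    head-only : ∀ {u} → Visits (v ∘ suc) u → ¬ Visits v u → u ≡ v r × v 0 ≢ v r
    head-only (t , t<r , v1+t≡u) no-tail with suc t ℕ.<? r
    ... | yes 1+t<r = ⊥-elim (no-tail (suc t , 1+t<r , v1+t≡u))
    ... | no 1+t≮r  = trans (sym v1+t≡u) (cong v 1+t≡r) ,
                      λ v0≡vr → no-tail (0 , 0<r , trans v0≡vr (trans (cong v (sym 1+t≡r)) v1+t≡u))
      where 1+t≡r = ℕ.≤-antisym t<r (ℕ.≮⇒≥ 1+t≮r)

    releasing : ∀ {u} → Visits v u → ¬ Visits (v ∘ suc) u → Releasing u
    releasing tail no-head with tail-only tail no-head
    ... | u≡v0 , v0≢vr = subst Releasing (sym u≡v0) (proj₁ (slack v0≢vr))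

    absorbing : ∀ {u} → Visits (v ∘ suc) u → ¬ Visits v u → Absorbing u
    absorbing head no-tail with head-only head no-tail
    ... | u≡vr , v0≢vr = subst Absorbing (sym u≡vr) (proj₂ (slack v0≢vr))

    forward-feasible : Feasible κ⁻ κ⁺ (override T? a b)
    forward-feasible u = shifted-bounds (visits? v u) (visits? (v ∘ suc) u)
      (subst₂ (λ h h′ → size (pt (override T? a b)) u + h ≡ ∣a∣ u + h′) (tail-hits u) (head-hits u)
        (size-override T? a b u))
      (proj₁ (a-feasible u)) (proj₂ (a-feasible u))
      (λ tail no-head → proj₁ (releasing tail no-head)) (λ head no-tail → proj₁ (absorbing head no-tail))

    backward-feasible : Feasible κ⁻ κ⁺ (override T? b a)
    backward-feasible u = shifted-bounds (visits? (v ∘ suc) u) (visits? v u)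
      (subst₂ (λ h h′ → size (pt (override T? b a)) u + h ≡ ∣b∣ u + h′) (head-hits u) (tail-hits u)
        (size-override T? b a u))
      (proj₁ (b-feasible u)) (proj₂ (b-feasible u))
      (λ head no-tail → proj₂ (absorbing head no-tail)) (λ tail no-head → proj₂ (releasing tail no-head))

  trail-decomposition : (W : Trail) → 0 < Trail.r W → Trail.Uncovered W → Slack W → NontrivialDecomposition κ⁻ κ⁺ y¹ D
  trail-decomposition W 0<r (j₁ , moved-j₁ , j₁∉T) slack = split-decomposition T? forward-feasible backward-feasible
    (lab 0 , (0 , 0<r , refl) , moved 0<r) (j₁ , j₁∉T , moved-j₁)
    where
    open Trail W
    open Cut W 0<r slack

  take : (W : Trail) → ∀ {m} → m ≤ Trail.r W → Trail
  take W {m} m≤r = record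
    { walk           = record { r = m ; v = v ; lab = lab ; leaves = leaves ∘ within ; enters = enters ∘ within }
    ; steps          = steps ∘ within
    ; tails-distinct = λ s<m t<m → tails-distinct (within s<m) (within t<m)
    ; heads-distinct = λ s<m t<m → heads-distinct (within s<m) (within t<m)
    }
    where
    open Trail W
    within : ∀ {t} → t < m → t < r
    within t<m = ℕ.<-≤-trans t<m m≤r

  drop : Trail → ℕ → Trail
  drop W α = record
    { walk           = record
      { r      = r ∸ α
      ; v      = λ t → v (α + t)
      ; lab    = λ t → lab (α + t)
      ; leaves = λ t< → leaves (shift< α t<)
      ; enters = λ {t} t< → trans (enters (shift< α t<)) (cong v (sym (ℕ.+-suc α t)))
      }
    ; steps          = λ {t} t< eq → steps (shift< α t<) (trans eq (cong v (ℕ.+-suc α t)))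
    ; tails-distinct = λ s< t< eq → ℕ.+-cancelˡ-≡ α _ _ (tails-distinct (shift< α s<) (shift< α t<) eq)
    ; heads-distinct = λ {s} {t} s< t< eq → ℕ.+-cancelˡ-≡ α _ _
        (heads-distinct (shift< α s<) (shift< α t<)
          (trans (cong v (sym (ℕ.+-suc α s))) (trans eq (cong v (ℕ.+-suc α t)))))
    }
    where open Trail W

  record Path (u₀ : Fin k) : Set where
    field
      walk : Walk
    open Walk walk public
    field
      injective : ∀ {s t} → s ≤ r → t ≤ r → v s ≡ v t → s ≡ t
      starts    : v 0 ≡ u₀
      nonempty  : 0 < r
      stuck     : ∀ j → ¬ Leaving (v r) j

    trail : Trail
    trail = path-trail walk injective

  record Cycle : Set where
    field
      walk : Walk
    open Walk walk public
    field
      injective : ∀ {s t} → s < r → t < r → v s ≡ v t → s ≡ t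
      closed    : v r ≡ v 0
      long      : 2 ≤ r

    trail : Trail
    trail = cycle-trail walk long closed injective

  Leaving? : ∀ u → Dec (∃ (Leaving u))
  Leaving? u = Fin.any? (λ j → ¬? (a j Fin.≟ b j) ×-dec (a j Fin.≟ u))

  module Follow {u₀} (leaving₀ : ∃ (Leaving u₀)) where

    exit : ∀ {u} → Dec (∃ (Leaving u)) → Fin n
    exit (yes (j , _)) = j
    exit (no _)        = proj₁ leaving₀  -- junk: only used at clusters that some moved item leaves

    next : ∀ {u} → Dec (∃ (Leaving u)) → Fin k
    next     (yes (j , _)) = b j
    next {u} (no _)        = u

    exit-leaves : ∀ {u} (d : Dec (∃ (Leaving u))) → ∃ (Leaving u) → Leaving u (exit d) × b (exit d) ≡ next d
    exit-leaves (yes (_ , leaving)) _    = leaving , refl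
    exit-leaves (no none)           some = ⊥-elim (none some)

    next-stuck : ∀ {u} (d : Dec (∃ (Leaving u))) → ¬ ∃ (Leaving u) → next d ≡ u
    next-stuck (yes some) none = ⊥-elim (none some)
    next-stuck (no _)     _    = refl

    w : ℕ → Fin k
    w zero    = u₀
    w (suc i) = next (Leaving? (w i))

    lab : ℕ → Fin n
    lab i = exit (Leaving? (w i))

    Repeats : ℕ → Set
    Repeats q = ∃ λ p → p < q × w p ≡ w q

    first-repeat : ∃ λ q → Repeats q × (∀ {q′} → q′ < q → ¬ Repeats q′)
    first-repeat = least (λ q → ℕ.anyUpTo? (λ p → w p Fin.≟ w q) q) (suc k) pigeonhole
      where
      pigeonhole : ∃ λ q → q < suc k × Repeats q
      pigeonhole with Fin.pigeonhole (ℕ.n<1+n k) (λ i → w (toℕ i))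
      ... | i , j , i<j , wi≡wj = toℕ j , Fin.toℕ<n j , toℕ i , i<j , wi≡wj

    module Repetition {t p} (p<q : p < suc t) (wp≡wq : w p ≡ w (suc t))
                      (no-earlier : ∀ {q′} → q′ < suc t → ¬ Repeats q′) where

      distinct : ∀ {s s′} → s < suc t → s′ < suc t → w s ≡ w s′ → s ≡ s′
      distinct {s} {s′} s<q s′<q ws≡ws′ with ℕ.<-cmp s s′
      ... | tri< s<s′ _ _ = ⊥-elim (no-earlier s′<q (s , s<s′ , ws≡ws′))
      ... | tri≈ _ s≡s′ _ = s≡s′
      ... | tri> _ _ s′<s = ⊥-elim (no-earlier s<q (s′ , s′<s , sym ws≡ws′))

      busy : ∀ {i} → i < t → ∃ (Leaving (w i))
      busy {i} i<t = decide (Leaving? (w i))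
        where
        decide : Dec (∃ (Leaving (w i))) → ∃ (Leaving (w i))
        decide (yes some) = some
        decide (no none)  = ⊥-elim (no-earlier (s≤s i<t) (i , ℕ.n<1+n i , sym (next-stuck (Leaving? (w i)) none)))

      edge : ∀ i → ∃ (Leaving (w i)) → Leaving (w i) (lab i) × b (lab i) ≡ w (suc i)
      edge i = exit-leaves (Leaving? (w i))

      path : ¬ ∃ (Leaving (w t)) → Path u₀
      path none = record
        { walk      = record
          { r      = t
          ; v      = w
          ; lab    = lab
          ; leaves = λ {i} i<t → proj₂ (proj₁ (edge i (busy i<t)))
          ; enters = λ {i} i<t → proj₂ (edge i (busy i<t))
          }
        ; injective = λ s≤t s′≤t → distinct (s≤s s≤t) (s≤s s′≤t)
        ; starts    = refl
        ; nonempty  = ℕ.n≢0⇒n>0 (λ { refl → none leaving₀ })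
        ; stuck     = λ j leaving → none (j , leaving)
        }

      cycle : ∃ (Leaving (w t)) → Cycle
      cycle some = record
        { walk      = record
          { r      = suc t ∸ p
          ; v      = λ i → w (p + i)
          ; lab    = λ i → lab (p + i)
          ; leaves = λ {i} i< → proj₂ (proj₁ (edge (p + i) (busy′ i<)))
          ; enters = λ {i} i< → trans (proj₂ (edge (p + i) (busy′ i<))) (cong w (sym (ℕ.+-suc p i)))
          }
        ; injective = λ s< s′< eq → ℕ.+-cancelˡ-≡ p _ _ (distinct (shift< p s<) (shift< p s′<) eq)
        ; closed    = trans (cong w (ℕ.m+[n∸m]≡n (ℕ.<⇒≤ p<q)))
                            (trans (sym wp≡wq) (cong w (sym (ℕ.+-identityʳ p))))
        ; long      = subst (2 ≤_) (sym (ℕ.+-∸-assoc 1 (ℕ.<⇒≤ p<t))) (s≤s (ℕ.m<n⇒0<n∸m p<t))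
        }
        where
        busy′ : ∀ {i} → i < suc t ∸ p → ∃ (Leaving (w (p + i)))
        busy′ {i} i< with ℕ.m≤n⇒m<n∨m≡n (ℕ.≤-pred (shift< p i<))
        ... | inj₁ p+i<t  = busy p+i<t
        ... | inj₂ p+i≡t  = subst (λ x → ∃ (Leaving (w x))) (sym p+i≡t) some
        p<t : p < t
        p<t with ℕ.m≤n⇒m<n∨m≡n (ℕ.≤-pred p<q)
        ... | inj₁ p<t  = p<t
        ... | inj₂ refl with edge t some
        ...   | (moved-j , aj≡wt) , bj≡w1+t = ⊥-elim (moved-j (trans aj≡wt (trans wp≡wq (sym bj≡w1+t))))

    path-or-cycle : Path u₀ ⊎ Cycle
    path-or-cycle with first-repeat
    ... | suc t , (p , p<q , wp≡wq) , no-earlier = by-last (Leaving? (w t))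
      where
      open Repetition p<q wp≡wq no-earlier
      by-last : Dec (∃ (Leaving (w t))) → Path u₀ ⊎ Cycle
      by-last (yes some) = inj₂ (cycle some)
      by-last (no none)  = inj₁ (path none)

  coverage : (W : Walk) → Walk.Covers W ⊎ Walk.Uncovered W
  coverage W = decide (Fin.any? (λ j → Moved? j ×-dec ¬? (visited? j)))
    where
    open Walk W
    visited? : ∀ j → Dec (∃ λ t → t < r × lab t ≡ j)
    visited? j = ℕ.anyUpTo? (λ t → lab t Fin.≟ j) r
    decide : Dec Uncovered → Covers ⊎ Uncovered
    decide (yes missed) = inj₂ missed
    decide (no none)    =
      inj₁ (λ j moved-j → decidable-stable (visited? j) (λ unvisited → none (j , moved-j , unvisited)))

  loser-leaves : ∀ {u} → ∣b∣ u < ∣a∣ u → ∃ (Leaving u)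
  loser-leaves {u} loses = hits≢0 Moved? {a} {u} nothing-leaves⇒¬loses
    where
    nothing-leaves⇒¬loses : hits Moved? a u ≢ 0
    nothing-leaves⇒¬loses no-hits = ℕ.<⇒≱ loses (begin
      ∣a∣ u                      ≤⟨ ℕ.m≤m+n (∣a∣ u) (hits Moved? b u) ⟩
      ∣a∣ u + hits Moved? b u    ≡⟨ flow u ⟨
      ∣b∣ u + hits Moved? a u    ≡⟨ cong (_+_ (∣b∣ u)) no-hits ⟩
      ∣b∣ u + 0                  ≡⟨ ℕ.+-identityʳ (∣b∣ u) ⟩
      ∣b∣ u                      ∎)
      where open ℕ.≤-Reasoning

  stuck-gains : ∀ {u j} → (∀ j → ¬ Leaving u j) → Entering u j → ∣a∣ u < ∣b∣ u
  stuck-gains {u} {j} stuck (moved-j , bj≡u) = begin-strict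
    ∣a∣ u                      <⟨ ℕ.m<m+n (∣a∣ u) (hits-positive Moved? j moved-j bj≡u) ⟩
    ∣a∣ u + hits Moved? b u    ≡⟨ flow u ⟨
    ∣b∣ u + hits Moved? a u    ≡⟨ cong (_+_ (∣b∣ u)) (hits-none Moved? (λ j moved-j aj≡u → stuck j (moved-j , aj≡u))) ⟩
    ∣b∣ u + 0                  ≡⟨ ℕ.+-identityʳ (∣b∣ u) ⟩
    ∣b∣ u                      ∎
    where open ℕ.≤-Reasoning

  path-end-gains : ∀ {u₀} (P : Path u₀) → let open Path P in ∣a∣ (v r) < ∣b∣ (v r)
  path-end-gains P = stuck-gains stuck
    (Trail.moved trail (pred<self nonempty) , trans (enters (pred<self nonempty)) (cong v (suc-pred nonempty)))
    where open Path P

  loser-releasing : ∀ {u} → ∣b∣ u < ∣a∣ u → Releasing u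
  loser-releasing {u} loses = ℕ.≤-<-trans (proj₁ (b-feasible u)) loses , ℕ.<-≤-trans loses (proj₂ (a-feasible u))

  gainer-absorbing : ∀ {u} → ∣a∣ u < ∣b∣ u → Absorbing u
  gainer-absorbing {u} gains = ℕ.<-≤-trans gains (proj₂ (b-feasible u)) , ℕ.≤-<-trans (proj₁ (a-feasible u)) gains

  free-balanced : ∀ {u} → Free¹ u → ∣a∣ u ≡ ∣b∣ u → Releasing u × Absorbing u
  free-balanced {u} free balanced with subst (λ s → κ⁻ u < s × s < κ⁺ u) (size¹ u) free
  ... | lo<a , a<hi = (lo<a , subst (_< κ⁺ u) balanced a<hi) , (a<hi , subst (κ⁻ u <_) balanced lo<a)

  module _ {u₀} (P : Path u₀) (releasing : Releasing u₀) where
    open Path P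

    starts-releasing : Releasing (v 0)
    starts-releasing = subst Releasing (sym starts) releasing

    uncovered-path-decomposition : Walk.Uncovered walk → NontrivialDecomposition κ⁻ κ⁺ y¹ D
    uncovered-path-decomposition uncovered = trail-decomposition trail nonempty uncovered
      (λ _ → starts-releasing , gainer-absorbing (path-end-gains P))

    free-interior-decomposition : Walk.Covers walk → ∀ {s} → s < r → 0 < s → Free¹ (v s) →
      NontrivialDecomposition κ⁻ κ⁺ y¹ D
    free-interior-decomposition covers {s} s<r 0<s free = trail-decomposition (take trail (ℕ.<⇒≤ s<r)) 0<s
      (lab s , Trail.moved trail s<r , λ { (t , t<s , lab-t≡lab-s) → ℕ.<-irrefl (revisits t<s lab-t≡lab-s) t<s })
      (λ _ → starts-releasing , proj₂ (free-balanced free balanced-s))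
      where
      revisits : ∀ {t} → t < s → lab t ≡ lab s → t ≡ s
      revisits {t} t<s lab-t≡lab-s = Trail.tails-distinct trail (ℕ.<-trans t<s s<r) s<r
        (trans (sym (leaves (ℕ.<-trans t<s s<r))) (trans (cong a lab-t≡lab-s) (leaves s<r)))
      balanced-s = Trail.balanced trail covers s<r (ℕ.≤-<-trans ℕ.pred[n]≤n s<r) (cong v (sym (suc-pred 0<s)))

  path-shape : ∀ {u₀} (P : Path u₀) → let open Path P in
    Walk.Covers walk → (∀ {s} → 0 < s → s < r → ¬ Free¹ (v s)) → PathNoFreeInterior κ⁻ κ⁺ y¹ D
  path-shape P covers fixed =
    r , v ∘ toℕ , lab ∘ toℕ , nonempty ,
    (λ s s′ eq → Fin.toℕ-injective (injective (ℕ.≤-pred (Fin.toℕ<n s)) (ℕ.≤-pred (Fin.toℕ<n s′)) eq)) ,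
    Trail.walk-edges trail covers ,
    λ s 0<s s<r → fixed 0<s s<r
    where open Path P

  module _ (C : Cycle) where
    open Cycle C

    0<r : 0 < r
    0<r = ℕ.≤-trans (s≤s z≤n) long

    uncovered-cycle-decomposition : Walk.Uncovered walk → NontrivialDecomposition κ⁻ κ⁺ y¹ D
    uncovered-cycle-decomposition uncovered =
      trail-decomposition trail 0<r uncovered (λ v0≢vr → ⊥-elim (v0≢vr (sym closed)))

    cycle-balanced : Walk.Covers walk → ∀ {m} → m < r → ∣a∣ (v m) ≡ ∣b∣ (v m)
    cycle-balanced covers {zero}  _     =
      Trail.balanced trail covers 0<r (pred<self 0<r) (trans (sym closed) (cong v (sym (suc-pred 0<r))))
    cycle-balanced covers {suc m} 1+m<r = Trail.balanced trail covers 1+m<r (ℕ.<-trans (ℕ.n<1+n m) 1+m<r) refl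

    free-pair-decomposition : Walk.Covers walk → ∀ {p q} → p < q → q < r → Free¹ (v p) → Free¹ (v q) →
      NontrivialDecomposition κ⁻ κ⁺ y¹ D
    free-pair-decomposition covers {p} {q} p<q q<r free-p free-q = trail-decomposition
      (take (drop trail p) (ℕ.∸-monoˡ-≤ p (ℕ.<⇒≤ q<r))) (ℕ.m<n⇒0<n∸m p<q)
      (lab q , Trail.moved trail q<r , λ { (t , t< , lab≡lab-q) → ℕ.<-irrefl (revisits (shift< p t<) lab≡lab-q) (shift< p t<) })
      (λ _ → subst Releasing (cong v (sym (ℕ.+-identityʳ p))) (proj₁ (free-balanced free-p balanced-p)) ,
             subst Absorbing (cong v (sym (ℕ.m+[n∸m]≡n (ℕ.<⇒≤ p<q)))) (proj₂ (free-balanced free-q balanced-q)))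
      where
      balanced-p = cycle-balanced covers (ℕ.<-trans p<q q<r)
      balanced-q = cycle-balanced covers q<r
      revisits : ∀ {t} → t < q → lab t ≡ lab q → t ≡ q
      revisits {t} t<q lab-t≡lab-q = injective (ℕ.<-trans t<q q<r) q<r
        (trans (sym (leaves (ℕ.<-trans t<q q<r))) (trans (cong a lab-t≡lab-q) (leaves q<r)))

    cycle-shape : Walk.Covers walk → (∀ {s t} → s < r → t < r → Free¹ (v s) → Free¹ (v t) → s ≡ t) →
      CycleAtMostOneFree κ⁻ κ⁺ y¹ D
    cycle-shape covers at-most-one =
      r , v ∘ toℕ , lab ∘ toℕ , long , trans (cong v (Fin.toℕ-fromℕ r)) closed ,
      (λ s s′ eq → Fin.toℕ-injective (injective (Fin.toℕ<n s) (Fin.toℕ<n s′) (untag s s′ eq))) ,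
      Trail.walk-edges trail covers ,
      λ s s′ free-s free-s′ → Fin.toℕ-injective (at-most-one (Fin.toℕ<n s) (Fin.toℕ<n s′)
        (subst (Free¹ ∘ v) (Fin.toℕ-inject₁ s) free-s) (subst (Free¹ ∘ v) (Fin.toℕ-inject₁ s′) free-s′))
      where
      untag : ∀ (s s′ : Fin r) → v (toℕ (inject₁ s)) ≡ v (toℕ (inject₁ s′)) → v (toℕ s) ≡ v (toℕ s′)
      untag s s′ eq = trans (cong v (sym (Fin.toℕ-inject₁ s))) (trans eq (cong v (Fin.toℕ-inject₁ s′)))

  module _ (indecomposable : ¬ NontrivialDecomposition κ⁻ κ⁺ y¹ D) where

    path-structure : ∀ {u₀} → Releasing u₀ → Path u₀ → PathNoFreeInterior κ⁻ κ⁺ y¹ D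
    path-structure releasing P with coverage (Path.walk P)
    ... | inj₂ uncovered = ⊥-elim (indecomposable (uncovered-path-decomposition P releasing uncovered))
    ... | inj₁ covers with ℕ.anyUpTo? (λ s → (0 ℕ.<? s) ×-dec Free¹? (Path.v P s)) (Path.r P)
    ...   | yes (s , s<r , 0<s , free) =
      ⊥-elim (indecomposable (free-interior-decomposition P releasing covers s<r 0<s free))
    ...   | no fixed = path-shape P covers (λ 0<s s<r free → fixed (_ , s<r , 0<s , free))

    cycle-structure : Cycle → CycleAtMostOneFree κ⁻ κ⁺ y¹ D
    cycle-structure C with coverage (Cycle.walk C)
    ... | inj₂ uncovered = ⊥-elim (indecomposable (uncovered-cycle-decomposition C uncovered))
    ... | inj₁ covers with ℕ.anyUpTo? (λ q → ℕ.anyUpTo? (λ p → Free¹? (v p) ×-dec Free¹? (v q)) q) (Cycle.r C)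
      where open Cycle C
    ...   | yes (q , q<r , p , p<q , free-p , free-q) =
      ⊥-elim (indecomposable (free-pair-decomposition C covers p<q q<r free-p free-q))
    ...   | no no-pair = cycle-shape C covers at-most-one
      where
      at-most-one : ∀ {s t} → s < Cycle.r C → t < Cycle.r C → Free¹ (Cycle.v C s) → Free¹ (Cycle.v C t) → s ≡ t
      at-most-one {s} {t} s<r t<r free-s free-t with ℕ.<-cmp s t
      ... | tri< s<t _ _ = ⊥-elim (no-pair (t , t<r , s , s<t , free-s , free-t))
      ... | tri≈ _ s≡t _ = s≡t
      ... | tri> _ _ t<s = ⊥-elim (no-pair (s , s<r , t , t<s , free-t , free-s))

    indecomposable⇒structure : ¬ (y¹ ≐ y²) → Structure
    indecomposable⇒structure y¹≢y² with Fin.any? (λ u → ∣b∣ u ℕ.<? ∣a∣ u)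
    ... | yes (u₀ , loses) =
      [ inj₂ ∘ inj₁ ∘ path-structure (loser-releasing loses) , inj₂ ∘ inj₂ ∘ cycle-structure ]′
        (Follow.path-or-cycle (loser-leaves loses))
    ... | no no-loser =
      [ ⊥-elim ∘ no-path , inj₂ ∘ inj₂ ∘ cycle-structure ]′ (Follow.path-or-cycle (j₀ , moved-j₀ , refl))
      where
      some-moved : ∃ Moved
      some-moved = Fin.¬∀⟶∃¬ n _ (λ j → a j Fin.≟ b j)
        (λ a≗b → y¹≢y² (λ i j → trans (y¹≐a i j) (trans (cong (δ i) (a≗b j)) (sym (y²≐b i j)))))
      j₀ = proj₁ some-moved
      moved-j₀ = proj₂ some-moved
      no-path : ∀ {u₀} → Path u₀ → ⊥
      no-path P = ℕ.<-irrefl (total-size a b)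
        (Σℕ-mono-< (λ u → ℕ.≮⇒≥ (λ loses → no-loser (u , loses))) (Path.v P (Path.r P)) (path-end-gains P))

lemma3 : (k n : ℕ) (κ⁻ κ⁺ : Fin k → ℕ) (y¹ y² : Fin k → Fin n → ℕ) →
    IsVertex κ⁻ κ⁺ y¹ → IsVertex κ⁻ κ⁺ y² → ¬ (y¹ ≐ y²) →
    (ShareEdge κ⁻ κ⁺ y¹ y² ⇔ (¬ NontrivialDecomposition κ⁻ κ⁺ y¹ (CDG y¹ y²)))
    × (ShareEdge κ⁻ κ⁺ y¹ y² ⇔
        (SingleEdge (CDG y¹ y²)
         ⊎ PathNoFreeInterior κ⁻ κ⁺ y¹ (CDG y¹ y²)
         ⊎ CycleAtMostOneFree κ⁻ κ⁺ y¹ (CDG y¹ y²)))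
lemma3 k n κ⁻ κ⁺ y¹ y² V¹ V² y¹≢y² =
  mk⇔ shareEdge⇒indecomposable (structure⇒shareEdge ∘ structure) ,
  mk⇔ (structure ∘ shareEdge⇒indecomposable) structure⇒shareEdge
  where
  open VertexPair κ⁻ κ⁺ V¹ V²
  structure : ¬ NontrivialDecomposition κ⁻ κ⁺ y¹ D → Structure
  structure indecomposable = indecomposable⇒structure indecomposable y¹≢y²
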